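{- Let $G$ be a thin spider with spider partition $(S,K,R)$, and let $e$ be a non-edge of $G$ with both endpoints in $S$. Then the ($P_4$-sparse,$+1$)-MinEdgeAddition Problem for $G$ and $e$ admits an optimal solution with exactly $\lambda$ fill edges (including $e$), where $\lambda=2|K|-3$ if $|R|=0$, $\lambda=2|K|-2$ if $|R|=1$, and $\lambda=2|K|-1$ if $|R|\ge2$.
   Context: All graphs are finite, simple, undirected. A graph is $P_4$-sparse if no five vertices induce more than one $P_4$. A thin spider is a graph whose vertex set has a partition $(S,K,R)$ with $S$ independent, $K$ a clique, $|S|=|K|\ge2$, every vertex of $R$ adjacent to all of $K$ and none of $S$, and a bijection $f:S\to K$ with $N(s)\cap K=\{f(s)\}$ for every $s\in S$. ($P_4$-sparse,$+1$)-MinEdgeAddition Problem: for a $P_4$-sparse graph $G$ and a non-edge $e$, a solution is a $P_4$-sparse graph $H$ with $V(H)=V(G)$ and $E(G)\cup\{e\}\subseteq E(H)$; fill edges are the edges of $E(H)\setminus E(G)$ (including $e$); an optimal solution minimizes their number. -}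

module Defs where

open import Data.Nat using (ℕ; zero; suc; _+_; _*_; _∸_; _≤_)
open import Data.Fin using (Fin; zero; suc; _<_)
open import Data.Bool using (Bool; true; false; if_then_else_; _∧_; not)
open import Data.Product using (Σ; _×_; _,_; ∃)
open import Data.Sum using (_⊎_)
open import Relation.Binary.PropositionalEquality using (_≡_; _≢_)
open import Function.Definitions using (Injective)

record Graph (n : ℕ) : Set where
  field
    adj    : Fin n → Fin n → Bool
    sym    : ∀ i j → adj i j ≡ adj j i
    irrefl : ∀ i → adj i i ≡ false
open Graph public

count : ∀ {n} → (Fin n → Bool) → ℕ
count {zero}  p = 0
count {suc n} p = (if p zero then 1 else 0) + count (λ i → p (suc i))

InducedP4 : ∀ {n} → Graph n → Fin n → Fin n → Fin n → Fin n → Set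
InducedP4 G a b c d =
  (a ≢ b × a ≢ c × a ≢ d × b ≢ c × b ≢ d × c ≢ d) ×
  (adj G a b ≡ true × adj G b c ≡ true × adj G c d ≡ true) ×
  (adj G a c ≡ false × adj G a d ≡ false × adj G b d ≡ false)

_∈₄_ : ∀ {n} → Fin n → (Fin n × Fin n × Fin n × Fin n) → Set
x ∈₄ (a , b , c , d) = x ≡ a ⊎ x ≡ b ⊎ x ≡ c ⊎ x ≡ d

InRange : ∀ {n} → (Fin 5 → Fin n) → Fin n → Set
InRange v x = ∃ λ i → v i ≡ x

-- P4-sparse: no five vertices induce more than one P4, i.e. any two induced
-- P4's whose vertices all lie among five (distinct) vertices have the same
-- vertex set.
P4Sparse : ∀ {n} → Graph n → Set
P4Sparse {n} G =
  (v : Fin 5 → Fin n) → Injective _≡_ _≡_ v →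
  ∀ a b c d a' b' c' d' →
  InducedP4 G a b c d → InducedP4 G a' b' c' d' →
  (∀ x → x ∈₄ (a , b , c , d) ⊎ x ∈₄ (a' , b' , c' , d') → InRange v x) →
  (∀ x → x ∈₄ (a , b , c , d) → x ∈₄ (a' , b' , c' , d')) ×
  (∀ x → x ∈₄ (a' , b' , c' , d') → x ∈₄ (a , b , c , d))

data Part : Set where
  inS inK inR : Part

isPart : Part → Part → Bool
isPart inS inS = true
isPart inK inK = true
isPart inR inR = true
isPart _   _   = false

-- A thin spider structure (S,K,R) on G with bijection f : S → K
-- (f given as a function on all vertices; only its values on S matter).
record ThinSpider {n : ℕ} (G : Graph n) : Set where
  field
    part     : Fin n → Part
    f        : Fin n → Fin n
    S-indep  : ∀ s t → part s ≡ inS → part t ≡ inS → adj G s t ≡ false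
    K-clique : ∀ k l → part k ≡ inK → part l ≡ inK → k ≢ l → adj G k l ≡ true
    S≡K      : count (λ x → isPart (part x) inS) ≡ count (λ x → isPart (part x) inK)
    S≥2      : 2 ≤ count (λ x → isPart (part x) inS)
    R-K      : ∀ r k → part r ≡ inR → part k ≡ inK → adj G r k ≡ true
    R-S      : ∀ r s → part r ≡ inR → part s ≡ inS → adj G r s ≡ false
    f-into   : ∀ s → part s ≡ inS → part (f s) ≡ inK
    f-inj    : ∀ s t → part s ≡ inS → part t ≡ inS → f s ≡ f t → s ≡ t
    f-surj   : ∀ k → part k ≡ inK → Σ (Fin n) λ s → part s ≡ inS × f s ≡ k
    S-nbhd   : ∀ s k → part s ≡ inS → part k ≡ inK →
               (adj G s k ≡ true → k ≡ f s) × (k ≡ f s → adj G s k ≡ true)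

  sizeK : ℕ
  sizeK = count (λ x → isPart (part x) inK)

  sizeR : ℕ
  sizeR = count (λ x → isPart (part x) inR)

Solution : ∀ {n} → Graph n → Fin n → Fin n → Graph n → Set
Solution {n} G u v H =
  P4Sparse H × (∀ i j → adj G i j ≡ true → adj H i j ≡ true) × adj H u v ≡ true

-- number of fill edges: unordered pairs {i,j} (counted once via i < j)
-- that are edges of H but not of G
fillCount : ∀ {n} → Graph n → Graph n → ℕ
fillCount {n} G H = go (λ i j → adj H i j ∧ not (adj G i j))
  where
  go : ∀ {m} → (Fin m → Fin m → Bool) → ℕ
  go {zero}  p = 0
  go {suc m} p = count (λ j → p zero (suc j)) + go (λ i j → p (suc i) (suc j))

lam : ℕ → ℕ → ℕ
lam k zero          = 2 * k ∸ 3
lam k (suc zero)    = 2 * k ∸ 2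
lam k (suc (suc r)) = 2 * k ∸ 1

{-# OPTIONS --safe #-}
-- Write a = f u and b = f v.  In any solution H the edges uv, ua, ab, bv form the square u – a – b – v,
-- and double counting the fill edges (2·fill = Σ fill degrees) gives
--   fill ≥ 1 + W + L(S ∖ {u,v}) + L(K ∖ {a,b}) + L(R),
-- where W counts the fill edges ub, va and L(x) the fill edges between x and {u, v, a, b}.
-- P4-sparseness of H on the five or six vertices involved forces L(s) + L(f s) ≥ 2 for every
-- s ∈ S ∖ {u,v}, W + L(r) ≥ 1 for r ∈ R, and W + L(r) + L(t) ≥ 2 for distinct r, t ∈ R; hence
-- fill ≥ λ = 1 + min(|R|, 2) + 2(|K| − 2).  These local facts are checked by enumerating all graphs
-- on five or six vertices.  The bound is attained by joining u and v to each other and to K ∖ {a,b},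
-- adding ub when R ≠ ∅ and va when |R| ≥ 2.  That graph is P4-sparse: by an enumeration of role
-- sequences its induced P4s lie in R, are s – f s – f t – t for s, t ∈ S ∖ {u,v}, or are v – u – a – r
-- (only when R = {r}), and two of them within five vertices have the same vertex set, because G is
-- P4-sparse for P4s in R and by counting vertices otherwise.
module Submission where

open import Data.Bool using (Bool; true; false; if_then_else_; _∧_; _∨_; not)
open import Data.Bool.Properties
  using (∧-zeroʳ; ∧-identityʳ; ∨-zeroʳ; ∨-identityʳ; ∨-comm; T-≡) renaming (_≟_ to _≟ᵇ_)
open import Data.Empty using (⊥; ⊥-elim)
open import Data.Fin as Fin using (Fin; zero; suc; punchIn)
open import Data.Fin.Patterns using (0F; 1F; 2F; 3F; 4F; 5F)
open import Data.Fin.Properties as Finₚ using (_≟_; suc-injective; pigeonhole; any?)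
open import Data.Maybe using (Maybe; just; nothing; is-just)
open import Data.Nat using (ℕ; zero; suc; _+_; _*_; _∸_; _≤_; _≤ᵇ_; z≤n; s≤s)
open import Data.Nat.Properties
  using (+-comm; +-assoc; +-identityʳ; *-identityʳ; *-zeroʳ; *-distribˡ-+; +-cancelˡ-≡; +-mono-≤; +-monoʳ-≤;
         *-monoʳ-≤; +-mono-<; m≤m+n; m≤n+m; n<1+n; ≤-trans; ≤-reflexive; ≤-antisym; _≤?_; <⇒≱; ≰⇒>;
         ≤ᵇ⇒≤; +-0-commutativeMonoid; module ≤-Reasoning)
open import Data.Nat.Solver using (module +-*-Solver)
open import Data.Product as Prod using (Σ; ∃; _×_; _,_; proj₁; proj₂)
open import Data.Sum as Sum using (_⊎_; inj₁; inj₂)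
open import Data.Unit using (⊤; tt)
open import Data.Vec using (Vec; []; _∷_; lookup; tabulate)
open import Data.Vec.Properties using (lookup∘tabulate)
open import Data.Vec.Relation.Unary.All as All using (All; []; _∷_)
open import Data.Vec.Relation.Unary.All.Properties using (lookup⁺)
open import Data.Vec.Relation.Unary.AllPairs using (AllPairs; []; _∷_)
open import Function using (_∘_; id; case_of_)
open import Function.Bundles using (Equivalence)
open import Function.Definitions using (Injective)
open import Relation.Binary using (tri<; tri≈; tri>)
open import Relation.Binary.PropositionalEquality
open import Relation.Nullary using (¬_; does; yes; no)
open import Relation.Nullary.Decidable using (Dec; dec-true; dec-false; ¬?; _×-dec_; _⊎-dec_; map′)
open +-*-Solver using (solve; _:+_; _:=_; con)
open import Algebra.Properties.CommutativeMonoid.Sum +-0-commutativeMonoid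
  using (sum; sum-cong-≗; sum-replicate-zero; ∑-distrib-+; ∑-comm)

open import Defs hiding (sym)

𝟙 : Bool → ℕ
𝟙 b = if b then 1 else 0

count≡sum : ∀ {n} (p : Fin n → Bool) → count p ≡ sum (𝟙 ∘ p)
count≡sum {zero}  p = refl
count≡sum {suc n} p = cong (𝟙 (p zero) +_) (count≡sum (p ∘ suc))

sum-mono-≤ : ∀ {n} {f g : Fin n → ℕ} → (∀ i → f i ≤ g i) → sum f ≤ sum g
sum-mono-≤ {zero}  f≤g = z≤n
sum-mono-≤ {suc n} f≤g = +-mono-≤ (f≤g zero) (sum-mono-≤ (f≤g ∘ suc))

sum-point : ∀ {n} (f : Fin n → ℕ) i → f i ≤ sum f
sum-point f zero    = m≤m+n _ _
sum-point f (suc i) = ≤-trans (sum-point (f ∘ suc) i) (m≤n+m _ _)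

sum-two-points : ∀ {n} (f : Fin n → ℕ) {i j} → i ≢ j → f i + f j ≤ sum f
sum-two-points f {zero}  {zero}  0≢0 = ⊥-elim (0≢0 refl)
sum-two-points f {zero}  {suc j} _   = +-monoʳ-≤ (f zero) (sum-point (f ∘ suc) j)
sum-two-points f {suc i} {zero}  _   =
  subst (_≤ sum f) (+-comm (f zero) (f (suc i))) (+-monoʳ-≤ (f zero) (sum-point (f ∘ suc) i))
sum-two-points f {suc i} {suc j} i≢j = ≤-trans (sum-two-points (f ∘ suc) (i≢j ∘ cong suc)) (m≤n+m _ _)

sum-single : ∀ {n} (f : Fin n → ℕ) i → (∀ j → j ≢ i → f j ≡ 0) → sum f ≡ f i
sum-single {suc n} f zero    f≡0 = begin
  f zero + sum (f ∘ suc)      ≡⟨ cong (f zero +_) (sum-cong-≗ (λ j → f≡0 (suc j) λ ())) ⟩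
  f zero + sum {n} (λ _ → 0)  ≡⟨ cong (f zero +_) (sum-replicate-zero n) ⟩
  f zero + 0                  ≡⟨ +-identityʳ (f zero) ⟩
  f zero                      ∎
  where open ≡-Reasoning
sum-single {suc n} f (suc i) f≡0 =
  cong₂ _+_ (f≡0 zero λ ()) (sum-single (f ∘ suc) i λ j j≢i → f≡0 (suc j) (j≢i ∘ suc-injective))

sumOn : ∀ {n} → (Fin n → Bool) → (Fin n → ℕ) → ℕ
sumOn p f = sum (λ i → if p i then f i else 0)

sumOn-point : ∀ {n} {p : Fin n → Bool} (f : Fin n → ℕ) {i} → p i ≡ true → f i ≤ sumOn p f
sumOn-point {p = p} f {i} pi≡true =
  subst (λ b → (if b then f i else 0) ≤ sumOn p f) pi≡true (sum-point _ i)

sumOn-two-points : ∀ {n} {p : Fin n → Bool} (f : Fin n → ℕ) {i j} → i ≢ j →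
                   p i ≡ true → p j ≡ true → f i + f j ≤ sumOn p f
sumOn-two-points {p = p} f {i} {j} i≢j pi≡true pj≡true =
  subst₂ (λ b c → (if b then f i else 0) + (if c then f j else 0) ≤ sumOn p f)
         pi≡true pj≡true (sum-two-points _ i≢j)

sumOn-mono-≤ : ∀ {n} (p : Fin n → Bool) {f g : Fin n → ℕ} →
               (∀ i → p i ≡ true → f i ≤ g i) → sumOn p f ≤ sumOn p g
sumOn-mono-≤ p {f} {g} f≤g = sum-mono-≤ λ i → pointwise i (p i) refl
  where
  pointwise : ∀ i b → p i ≡ b → (if b then f i else 0) ≤ (if b then g i else 0)
  pointwise i true  pi≡true = f≤g i pi≡true
  pointwise i false _       = z≤n

sumOn-cong : ∀ {n} (p : Fin n → Bool) {f g : Fin n → ℕ} →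
             (∀ i → p i ≡ true → f i ≡ g i) → sumOn p f ≡ sumOn p g
sumOn-cong p {f} {g} f≡g = sum-cong-≗ λ i → pointwise i (p i) refl
  where
  pointwise : ∀ i b → p i ≡ b → (if b then f i else 0) ≡ (if b then g i else 0)
  pointwise i true  pi≡true = f≡g i pi≡true
  pointwise i false _       = refl

sumOn-+ : ∀ {n} (p : Fin n → Bool) (f g : Fin n → ℕ) → sumOn p (λ i → f i + g i) ≡ sumOn p f + sumOn p g
sumOn-+ {n} p f g = trans (sum-cong-≗ λ i → split (p i)) (∑-distrib-+ {n} (λ i → if p i then f i else 0) _)
  where
  split : ∀ {i} b → (if b then f i + g i else 0) ≡ (if b then f i else 0) + (if b then g i else 0)
  split true  = refl
  split false = refl

if-then-0 : ∀ b c → (if b then c else 0) ≡ c * 𝟙 b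
if-then-0 true  c = sym (*-identityʳ c)
if-then-0 false c = sym (*-zeroʳ c)

sumOn-const : ∀ {n} (p : Fin n → Bool) c → sumOn p (λ _ → c) ≡ c * count p
sumOn-const {zero}  p c = sym (*-zeroʳ c)
sumOn-const {suc n} p c = begin
  (if p zero then c else 0) + sumOn (p ∘ suc) (λ _ → c)  ≡⟨ cong₂ _+_ (if-then-0 (p zero) c) (sumOn-const (p ∘ suc) c) ⟩
  c * 𝟙 (p zero) + c * count (p ∘ suc)                   ≡⟨ *-distribˡ-+ c (𝟙 (p zero)) _ ⟨
  c * count p                                            ∎
  where open ≡-Reasoning

count-none : ∀ {n} (p : Fin n → Bool) → (∀ i → p i ≡ false) → count p ≡ 0
count-none {zero}  p none = refl
count-none {suc n} p none rewrite none zero = count-none (p ∘ suc) (none ∘ suc)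

count-≤1 : ∀ {n} (p : Fin n → Bool) → (∀ i j → p i ≡ true → p j ≡ true → i ≡ j) → count p ≤ 1
count-≤1 {zero}  p unique = z≤n
count-≤1 {suc n} p unique with p zero in p0
... | true  = ≤-reflexive (cong suc (count-none (p ∘ suc) others))
  where
  others : ∀ i → p (suc i) ≡ false
  others i with p (suc i) in pi
  ... | true  with () ← unique zero (suc i) p0 pi
  ... | false = refl
... | false = count-≤1 (p ∘ suc) λ i j pi pj → suc-injective (unique (suc i) (suc j) pi pj)

count-witness : ∀ {n} (p : Fin n → Bool) → 1 ≤ count p → ∃ λ i → p i ≡ true
count-witness p 1≤count with any? (λ i → p i ≟ᵇ true)
... | yes witness = witness
... | no  none    = ⊥-elim (<⇒≱ 1≤count (≤-reflexive (count-none p λ i → not-true (none ∘ (i ,_)))))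
  where
  not-true : ∀ {b} → b ≢ true → b ≡ false
  not-true {false} _      = refl
  not-true {true}  b≢true = ⊥-elim (b≢true refl)

count-two-witnesses : ∀ {n} (p : Fin n → Bool) → 2 ≤ count p →
                      ∃ λ i → ∃ λ j → i ≢ j × p i ≡ true × p j ≡ true
count-two-witnesses p 2≤count with count-witness p (≤-trans (s≤s z≤n) 2≤count)
... | i , pi with any? (λ j → ¬? (j ≟ i) ×-dec p j ≟ᵇ true)
...   | yes (j , j≢i , pj) = i , j , j≢i ∘ sym , pi , pj
...   | no  none = ⊥-elim (<⇒≱ 2≤count (count-≤1 p all-i))
  where
  only-i : ∀ j → p j ≡ true → j ≡ i
  only-i j pj with j ≟ i
  ... | yes j≡i = j≡i
  ... | no  j≢i = ⊥-elim (none (j , j≢i , pj))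
  all-i : ∀ j k → p j ≡ true → p k ≡ true → j ≡ k
  all-i j k pj pk = trans (only-i j pj) (sym (only-i k pk))

sumOn-injection : ∀ {n} (p q : Fin n → Bool) (σ : Fin n → Fin n) (f : Fin n → ℕ) →
                  (∀ i → p i ≡ true → q (σ i) ≡ true) →
                  (∀ i j → p i ≡ true → p j ≡ true → σ i ≡ σ j → i ≡ j) →
                  sumOn p (f ∘ σ) ≤ sumOn q f
sumOn-injection {n} p q σ f p⇒q σ-inj = begin
  sumOn p (f ∘ σ)                                      ≡⟨ sum-cong-≗ spread ⟩
  sum (λ i → sum (λ j → if hits i j then f j else 0))  ≡⟨ ∑-comm {n} {n} (λ i j → if hits i j then f j else 0) ⟩
  sum (λ j → sum (λ i → if hits i j then f j else 0))  ≤⟨ sum-mono-≤ collect ⟩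
  sumOn q f                                            ∎
  where
  open ≤-Reasoning
  hits : Fin n → Fin n → Bool
  hits i j = p i ∧ does (σ i ≟ j)

  hits-sound : ∀ {i j} → hits i j ≡ true → p i ≡ true × σ i ≡ j
  hits-sound {i} {j} _ with p i | σ i ≟ j
  hits-sound refl | true | yes σi≡j = refl , σi≡j

  spread : ∀ i → (if p i then f (σ i) else 0) ≡ sum (λ j → if hits i j then f j else 0)
  spread i = sym (trans (sum-single _ (σ i) off) on)
    where
    off : ∀ j → j ≢ σ i → (if p i ∧ does (σ i ≟ j) then f j else 0) ≡ 0
    off j j≢σi rewrite dec-false (σ i ≟ j) (j≢σi ∘ sym) | ∧-zeroʳ (p i) = refl
    on : (if p i ∧ does (σ i ≟ σ i) then f (σ i) else 0) ≡ (if p i then f (σ i) else 0)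
    on rewrite dec-true (σ i ≟ σ i) refl | ∧-identityʳ (p i) = refl

  collect : ∀ j → sum (λ i → if hits i j then f j else 0) ≤ (if q j then f j else 0)
  collect j rewrite sumOn-const (λ i → hits i j) (f j) with q j in qj
  ... | true  = ≤-trans (*-monoʳ-≤ (f j) (count-≤1 _ at-most-one)) (≤-reflexive (*-identityʳ (f j)))
    where
    at-most-one : ∀ i i′ → hits i j ≡ true → hits i′ j ≡ true → i ≡ i′
    at-most-one i i′ hi hi′ with hits-sound hi | hits-sound hi′
    ... | pi , σi≡j | pi′ , σi′≡j = σ-inj i i′ pi pi′ (trans σi≡j (sym σi′≡j))
  ... | false = ≤-reflexive (trans (cong (f j *_) (count-none _ missed)) (*-zeroʳ (f j)))
    where
    missed : ∀ i → hits i j ≡ false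
    missed i with hits i j in hi
    ... | false = refl
    ... | true with hits-sound hi
    ...   | pi , refl with () ← trans (sym (p⇒q i pi)) qj

half-≤ : ∀ m n → m + m ≤ n + n → m ≤ n
half-≤ m n m+m≤n+n with m ≤? n
... | yes m≤n = m≤n
... | no  m≰n = ⊥-elim (<⇒≱ (+-mono-< (≰⇒> m≰n) (≰⇒> m≰n)) m+m≤n+n)

double-injective : ∀ m n → m + m ≡ n + n → m ≡ n
double-injective m n eq = ≤-antisym (half-≤ m n (≤-reflexive eq)) (half-≤ n m (≤-reflexive (sym eq)))

regroup : ∀ p q r s t → p + (q + (r + (s + t))) ≡ p + (q + (r + s)) + t
regroup = solve 5 (λ p q r s t → p :+ (q :+ (r :+ (s :+ t))) := p :+ (q :+ (r :+ s)) :+ t) refl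

∧-≡ : ∀ {a b} → a ≡ true → b ≡ true → a ∧ b ≡ true
∧-≡ refl b≡true = b≡true

∧-≡-split : ∀ {a b} → a ∧ b ≡ true → a ≡ true × b ≡ true
∧-≡-split {true} b≡true = refl , b≡true

induced : ∀ {n k} → Graph n → (Fin k → Fin n) → Graph k
induced H ι = record
  { adj    = λ i j → adj H (ι i) (ι j)
  ; sym    = λ i j → Graph.sym H (ι i) (ι j)
  ; irrefl = λ i → Graph.irrefl H (ι i)
  }

module _ {n k} {H : Graph n} {Y : Graph k} {ι : Fin k → Fin n} (ι-inj : Injective _≡_ _≡_ ι)
         (agree : ∀ i j → adj Y i j ≡ adj H (ι i) (ι j)) where

  InducedP4-embed : ∀ {a b c d} → InducedP4 Y a b c d → InducedP4 H (ι a) (ι b) (ι c) (ι d)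
  InducedP4-embed {a} {b} {c} {d} ((a≢b , a≢c , a≢d , b≢c , b≢d , c≢d) , (ab , bc , cd) , (ac , ad , bd)) =
    (a≢b ∘ ι-inj , a≢c ∘ ι-inj , a≢d ∘ ι-inj , b≢c ∘ ι-inj , b≢d ∘ ι-inj , c≢d ∘ ι-inj) ,
    (move a b ab , move b c bc , move c d cd) , (move a c ac , move a d ad , move b d bd)
    where
    move : ∀ i j {β} → adj Y i j ≡ β → adj H (ι i) (ι j) ≡ β
    move i j = trans (sym (agree i j))

  ∈₄-embed : ∀ {x a b c d} → x ∈₄ (a , b , c , d) → ι x ∈₄ (ι a , ι b , ι c , ι d)
  ∈₄-embed = Sum.map (cong ι) (Sum.map (cong ι) (Sum.map (cong ι) (cong ι)))

  ∈₄-reflect : ∀ {x a b c d} → ι x ∈₄ (ι a , ι b , ι c , ι d) → x ∈₄ (a , b , c , d)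
  ∈₄-reflect = Sum.map ι-inj (Sum.map ι-inj (Sum.map ι-inj ι-inj))

  ∈₄-preimage : ∀ {y a b c d} → y ∈₄ (ι a , ι b , ι c , ι d) → ∃ λ x → x ∈₄ (a , b , c , d) × ι x ≡ y
  ∈₄-preimage (inj₁ refl)               = _ , inj₁ refl , refl
  ∈₄-preimage (inj₂ (inj₁ refl))        = _ , inj₂ (inj₁ refl) , refl
  ∈₄-preimage (inj₂ (inj₂ (inj₁ refl))) = _ , inj₂ (inj₂ (inj₁ refl)) , refl
  ∈₄-preimage (inj₂ (inj₂ (inj₂ refl))) = _ , inj₂ (inj₂ (inj₂ refl)) , refl

  P4Sparse-embed : P4Sparse H → P4Sparse Y
  P4Sparse-embed sparse w w-inj a b c d a′ b′ c′ d′ P P′ in-range =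
    Prod.map (λ sub x → ∈₄-reflect ∘ sub (ι x) ∘ ∈₄-embed) (λ sub x → ∈₄-reflect ∘ sub (ι x) ∘ ∈₄-embed)
      (sparse (ι ∘ w) (w-inj ∘ ι-inj) _ _ _ _ _ _ _ _ (InducedP4-embed P) (InducedP4-embed P′) in-range′)
    where
    in-range′ : ∀ y → y ∈₄ (ι a , ι b , ι c , ι d) ⊎ y ∈₄ (ι a′ , ι b′ , ι c′ , ι d′) → InRange (ι ∘ w) y
    in-range′ y (inj₁ y∈) with ∈₄-preimage y∈
    ... | x , x∈ , refl with in-range x (inj₁ x∈)
    ...   | i , refl = i , refl
    in-range′ y (inj₂ y∈) with ∈₄-preimage y∈
    ... | x , x∈ , refl with in-range x (inj₂ x∈)
    ...   | i , refl = i , refl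

lookup-AllPairs : ∀ {A : Set} {ρ : A → A → Set} {m} {xs : Vec A m} → AllPairs ρ xs →
                  ∀ {i j} → i Fin.< j → ρ (lookup xs i) (lookup xs j)
lookup-AllPairs (ρx ∷ _)  {zero}  {suc j} _         = lookup⁺ ρx j
lookup-AllPairs (_ ∷ ρxs) {suc i} {suc j} (s≤s i<j) = lookup-AllPairs ρxs i<j

lookup-injective : ∀ {A : Set} {m} {xs : Vec A m} → AllPairs _≢_ xs → Injective _≡_ _≡_ (lookup xs)
lookup-injective distinct {i} {j} same with Finₚ.<-cmp i j
... | tri< i<j _ _ = ⊥-elim (lookup-AllPairs distinct i<j same)
... | tri≈ _ i≡j _ = i≡j
... | tri> _ _ j<i = ⊥-elim (lookup-AllPairs distinct j<i (sym same))

P4Sparse-lookup : ∀ {n k} {H : Graph n} {xs : Vec (Fin n) k} → AllPairs _≢_ xs → P4Sparse H →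
                  P4Sparse (induced H (lookup xs))
P4Sparse-lookup {H = H} {xs} distinct =
  P4Sparse-embed {H = H} {Y = induced H (lookup xs)} {ι = lookup xs} (lookup-injective distinct) (λ _ _ → refl)

six-not-among-five : ∀ {n} (w : Fin 5 → Fin n) (xs : Vec (Fin n) 6) → AllPairs _≢_ xs → ¬ All (InRange w) xs
six-not-among-five w xs distinct in-range =
  let i , j , i<j , same-index = pigeonhole (n<1+n 5) (proj₁ ∘ in-range-at)
  in lookup-AllPairs distinct i<j
       (trans (sym (proj₂ (in-range-at i))) (trans (cong w same-index) (proj₂ (in-range-at j))))
  where
  in-range-at : ∀ i → InRange w (lookup xs i)
  in-range-at i = lookup⁺ in-range i

Quadruple : ℕ → Set
Quadruple k = Fin k × Fin k × Fin k × Fin k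

IsP4 : ∀ {k} → Graph k → Quadruple k → Set
IsP4 X (a , b , c , d) = InducedP4 X a b c d

here₀ : ∀ {k} {a b c d : Fin k} → a ∈₄ (a , b , c , d)
here₀ = inj₁ refl
here₁ : ∀ {k} {a b c d : Fin k} → b ∈₄ (a , b , c , d)
here₁ = inj₂ (inj₁ refl)
here₂ : ∀ {k} {a b c d : Fin k} → c ∈₄ (a , b , c , d)
here₂ = inj₂ (inj₂ (inj₁ refl))
here₃ : ∀ {k} {a b c d : Fin k} → d ∈₄ (a , b , c , d)
here₃ = inj₂ (inj₂ (inj₂ refl))

SameVertices : ∀ {k} → Quadruple k → Quadruple k → Set
SameVertices q q′ = (∀ x → x ∈₄ q → x ∈₄ q′) × (∀ x → x ∈₄ q′ → x ∈₄ q)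

reverse : ∀ {k} → Quadruple k → Quadruple k
reverse (a , b , c , d) = d , c , b , a

∈₄-reverse : ∀ {k} {x : Fin k} q → x ∈₄ q → x ∈₄ reverse q
∈₄-reverse _ (inj₁ x≡a)               = inj₂ (inj₂ (inj₂ x≡a))
∈₄-reverse _ (inj₂ (inj₁ x≡b))        = inj₂ (inj₂ (inj₁ x≡b))
∈₄-reverse _ (inj₂ (inj₂ (inj₁ x≡c))) = inj₂ (inj₁ x≡c)
∈₄-reverse _ (inj₂ (inj₂ (inj₂ x≡d))) = inj₁ x≡d

∈₄-unreverse : ∀ {k} {x : Fin k} q → x ∈₄ reverse q → x ∈₄ q
∈₄-unreverse (a , b , c , d) = ∈₄-reverse (d , c , b , a)

SameVertices-unreverseˡ : ∀ {k} {q q′ : Quadruple k} → SameVertices (reverse q) q′ → SameVertices q q′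
SameVertices-unreverseˡ {q = q} (to , from) = (λ x → to x ∘ ∈₄-reverse q) , (λ x → ∈₄-unreverse q ∘ from x)

SameVertices-unreverseʳ : ∀ {k} {q q′ : Quadruple k} → SameVertices q (reverse q′) → SameVertices q q′
SameVertices-unreverseʳ {q′ = q′} (to , from) = (λ x → ∈₄-unreverse q′ ∘ to x) , (λ x → from x ∘ ∈₄-reverse q′)

InducedP4-reverse : ∀ {k} {X : Graph k} {a b c d} → InducedP4 X a b c d → InducedP4 X d c b a
InducedP4-reverse {X = X} {a} {b} {c} {d} ((a≢b , a≢c , a≢d , b≢c , b≢d , c≢d) , (ab , bc , cd) , (ac , ad , bd)) =
  ((c≢d ∘ sym) , (b≢d ∘ sym) , (a≢d ∘ sym) , (b≢c ∘ sym) , (a≢c ∘ sym) , (a≢b ∘ sym)) ,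
  (flip c d cd , flip b c bc , flip a b ab) , (flip b d bd , flip a d ad , flip a c ac)
  where
  flip : ∀ p q {β} → adj X p q ≡ β → adj X q p ≡ β
  flip p q = trans (Graph.sym X q p)

fill : ∀ {n} → Graph n → Graph n → Fin n → Fin n → Bool
fill G H i j = adj H i j ∧ not (adj G i j)

fill-sym : ∀ {n} (G H : Graph n) i j → fill G H i j ≡ fill G H j i
fill-sym G H i j = cong₂ (λ h g → h ∧ not g) (Graph.sym H i j) (Graph.sym G i j)

fill-irrefl : ∀ {n} (G H : Graph n) i → fill G H i i ≡ false
fill-irrefl G H i = cong (_∧ not (adj G i i)) (Graph.irrefl H i)

fill-on-edge : ∀ {n} {G H : Graph n} {x y} → adj G x y ≡ true → fill G H x y ≡ false
fill-on-edge {H = H} {x} {y} xy∈G rewrite xy∈G = ∧-zeroʳ (adj H x y)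

fill-off-edge : ∀ {n} {G H : Graph n} {x y} → adj G x y ≡ false → fill G H x y ≡ adj H x y
fill-off-edge {H = H} {x} {y} xy∉G rewrite xy∉G = ∧-identityʳ (adj H x y)

fillCount-handshake : ∀ {n} (G H : Graph n) → fillCount G H + fillCount G H ≡ sum (λ i → count (fill G H i))
fillCount-handshake {zero}  G H = refl
fillCount-handshake {suc n} G H = begin
  (c + f′) + (c + f′)                                         ≡⟨ +-assoc c f′ (c + f′) ⟩
  c + (f′ + (c + f′))                                         ≡⟨ cong (c +_) (+-comm f′ (c + f′)) ⟩
  c + ((c + f′) + f′)                                         ≡⟨ cong (c +_) (+-assoc c f′ f′) ⟩
  c + (c + (f′ + f′))                                         ≡⟨ cong₂ _+_ first-row (cong₂ _+_ first-column
                                                                   (fillCount-handshake (induced G suc) (induced H suc))) ⟩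
  count (fill G H zero) + (sum first-column-terms + sum rest)  ≡⟨ cong (count (fill G H zero) +_)
                                                                      (∑-distrib-+ {n} first-column-terms rest) ⟨
  sum (λ i → count (fill G H i))                              ∎
  where
  open ≡-Reasoning
  c f′ : ℕ
  c  = count (fill G H zero ∘ suc)
  f′ = fillCount (induced G suc) (induced H suc)
  first-column-terms rest : Fin n → ℕ
  first-column-terms i = 𝟙 (fill G H (suc i) zero)
  rest i = count (fill G H (suc i) ∘ suc)
  first-row : c ≡ count (fill G H zero)
  first-row = cong (λ b → 𝟙 b + c) (sym (fill-irrefl G H zero))
  first-column : c ≡ sum first-column-terms
  first-column = trans (count≡sum (fill G H zero ∘ suc)) (sum-cong-≗ λ i → cong 𝟙 (fill-sym G H zero (suc i)))

-- Configurations on five or six vertices, decided by enumerating all graphs on them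

Table : ℕ → Set
Table zero    = ⊤
Table (suc k) = Vec Bool k × Table k

tableAdj : ∀ {k} → Table k → Fin k → Fin k → Bool
tableAdj (row , rest) zero    zero    = false
tableAdj (row , rest) zero    (suc j) = lookup row j
tableAdj (row , rest) (suc i) zero    = lookup row i
tableAdj (row , rest) (suc i) (suc j) = tableAdj rest i j

graphOf : ∀ {k} → Table k → Graph k
graphOf t = record { adj = tableAdj t ; sym = symmetric t ; irrefl = irreflexive t }
  where
  symmetric : ∀ {k} (t : Table k) i j → tableAdj t i j ≡ tableAdj t j i
  symmetric (row , rest) zero    zero    = refl
  symmetric (row , rest) zero    (suc j) = refl
  symmetric (row , rest) (suc i) zero    = refl
  symmetric (row , rest) (suc i) (suc j) = symmetric rest i j
  irreflexive : ∀ {k} (t : Table k) i → tableAdj t i i ≡ false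
  irreflexive (row , rest) zero    = refl
  irreflexive (row , rest) (suc i) = irreflexive rest i

table : ∀ {k} → Graph k → Table k
table {zero}  X = tt
table {suc k} X = tabulate (adj X zero ∘ suc) , table (induced X suc)

table-correct : ∀ {k} (X : Graph k) i j → tableAdj (table X) i j ≡ adj X i j
table-correct X zero    zero    = sym (Graph.irrefl X zero)
table-correct X zero    (suc j) = lookup∘tabulate (adj X zero ∘ suc) j
table-correct X (suc i) zero    = trans (lookup∘tabulate (adj X zero ∘ suc) i) (Graph.sym X zero (suc i))
table-correct X (suc i) (suc j) = table-correct (induced X suc) i j

everyVec : ∀ {m} → (Vec Bool m → Bool) → Bool
everyVec {zero}  P = P []
everyVec {suc m} P = everyVec (P ∘ (true ∷_)) ∧ everyVec (P ∘ (false ∷_))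

everyVec-sound : ∀ {m} (P : Vec Bool m → Bool) → everyVec P ≡ true → ∀ row → P row ≡ true
everyVec-sound P holds []            = holds
everyVec-sound P holds (true ∷ row)  = everyVec-sound (P ∘ (true ∷_))  (proj₁ (∧-≡-split holds)) row
everyVec-sound P holds (false ∷ row) = everyVec-sound (P ∘ (false ∷_)) (proj₂ (∧-≡-split holds)) row

everyTable : ∀ {k} → (Table k → Bool) → Bool
everyTable {zero}  P = P tt
everyTable {suc k} P = everyVec (λ row → everyTable (λ rest → P (row , rest)))

everyTable-sound : ∀ {k} (P : Table k → Bool) → everyTable P ≡ true → ∀ t → P t ≡ true
everyTable-sound {zero}  P holds tt           = holds
everyTable-sound {suc k} P holds (row , rest) =
  everyTable-sound (λ rest → P (row , rest)) (everyVec-sound _ holds row) rest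

IsP4? : ∀ {k} (X : Graph k) q → Dec (IsP4 X q)
IsP4? X (a , b , c , d) =
  (¬? (a ≟ b) ×-dec ¬? (a ≟ c) ×-dec ¬? (a ≟ d) ×-dec ¬? (b ≟ c) ×-dec ¬? (b ≟ d) ×-dec ¬? (c ≟ d)) ×-dec
  (adj X a b ≟ᵇ true ×-dec adj X b c ≟ᵇ true ×-dec adj X c d ≟ᵇ true) ×-dec
  (adj X a c ≟ᵇ false ×-dec adj X a d ≟ᵇ false ×-dec adj X b d ≟ᵇ false)

∈₄? : ∀ {k} (x : Fin k) q → Dec (x ∈₄ q)
∈₄? x (a , b , c , d) = x ≟ a ⊎-dec x ≟ b ⊎-dec x ≟ c ⊎-dec x ≟ d

any-quadruple? : ∀ {k} {P : Quadruple k → Set} → (∀ q → Dec (P q)) → Dec (∃ P)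
any-quadruple? P? =
  map′ (λ (a , b , c , d , p) → (a , b , c , d) , p) (λ ((a , b , c , d) , p) → a , b , c , d , p)
       (any? λ a → any? λ b → any? λ c → any? λ d → P? (a , b , c , d))

TwoP4s : ∀ {k} → Graph k → Set
TwoP4s X = ∃ λ q → IsP4 X q × ∃ λ q′ → IsP4 X q′ × ∃ λ x → x ∈₄ q × ¬ x ∈₄ q′

TwoP4s? : ∀ {k} (X : Graph k) → Dec (TwoP4s X)
TwoP4s? X = any-quadruple? λ q → IsP4? X q ×-dec any-quadruple? λ q′ → IsP4? X q′ ×-dec
            any? λ x → ∈₄? x q ×-dec ¬? (∈₄? x q′)

TwoP4s⇒¬P4Sparse : (Y : Graph 5) → TwoP4s Y → ¬ P4Sparse Y
TwoP4s⇒¬P4Sparse Y (_ , P , _ , P′ , x , x∈ , x∉) sparse =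
  x∉ (proj₁ (sparse id id _ _ _ _ _ _ _ _ P P′ (λ y _ → y , refl)) x x∈)

TwoP4sAmongFive : Graph 6 → Set
TwoP4sAmongFive X = ∃ λ z → TwoP4s (induced X (punchIn z))

TwoP4sAmongFive? : (X : Graph 6) → Dec (TwoP4sAmongFive X)
TwoP4sAmongFive? X = any? λ z → TwoP4s? (induced X (punchIn z))

TwoP4sAmongFive⇒¬P4Sparse : (X : Graph 6) → TwoP4sAmongFive X → ¬ P4Sparse X
TwoP4sAmongFive⇒¬P4Sparse X (z , two) sparse =
  TwoP4s⇒¬P4Sparse (induced X (punchIn z)) two
    (P4Sparse-embed {H = X} {Y = induced X (punchIn z)} {ι = punchIn z} (λ {i} {j} → Finₚ.punchIn-injective z i j)
                    (λ _ _ → refl) sparse)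

witness : ∀ {A : Set} (A? : Dec A) → does A? ≡ true → A
witness (yes a) _ = a

module Exhaustion {k} (Obstruction : Graph k → Set) (obstruction? : ∀ X → Dec (Obstruction X))
                  (obstruction⇒¬P4Sparse : ∀ X → Obstruction X → ¬ P4Sparse X) where

  -- The check is stated as an equation, not via T, because Agda evaluates refl proofs much faster.
  by-exhaustion : (C D : Table k → Bool) →
                  (everyTable λ t → not (C t) ∨ D t ∨ does (obstruction? (graphOf t))) ≡ true →
                  ∀ X → P4Sparse X → C (table X) ≡ true → D (table X) ≡ true
  by-exhaustion C D holds X sparse =
    modus-ponens (C (table X)) (D (table X)) _ (everyTable-sound _ holds (table X))
      (λ obstructed → obstruction⇒¬P4Sparse _ (witness (obstruction? _) obstructed)
        (P4Sparse-embed {H = X} {Y = graphOf (table X)} {ι = id} id (table-correct X) sparse))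
    where
    modus-ponens : ∀ c d o → not c ∨ d ∨ o ≡ true → o ≢ true → c ≡ true → d ≡ true
    modus-ponens true true  o    _ _  _ = refl
    modus-ponens true false true _ ¬o _ = ⊥-elim (¬o refl)

open Exhaustion {5} TwoP4s TwoP4s? TwoP4s⇒¬P4Sparse renaming (by-exhaustion to by-exhaustion₅)
open Exhaustion {6} TwoP4sAmongFive TwoP4sAmongFive? TwoP4sAmongFive⇒¬P4Sparse
  renaming (by-exhaustion to by-exhaustion₆)

≤ᵇ-true⇒≤ : ∀ m n → (m ≤ᵇ n) ≡ true → m ≤ n
≤ᵇ-true⇒≤ m n = ≤ᵇ⇒≤ m n ∘ Equivalence.from T-≡

-- The square is u – a – b – v – u; the tables below list its vertices first, in the order u, v, a, b.
module Square {n} {H : Graph n} (sparse : P4Sparse H) {u v a b : Fin n}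
              (square-distinct : AllPairs _≢_ (u ∷ v ∷ a ∷ b ∷ []))
              (uv : adj H u v ≡ true) (ua : adj H u a ≡ true) (vb : adj H v b ≡ true) (ab : adj H a b ≡ true) where

  Outside : Fin n → Set
  Outside x = x ≢ u × x ≢ v × x ≢ a × x ≢ b

  with-square : ∀ {k} {xs : Vec (Fin n) k} → All Outside xs → AllPairs _≢_ xs → AllPairs _≢_ (u ∷ v ∷ a ∷ b ∷ xs)
  with-square {xs = xs} outside distinct = extend square-distinct
    where
    extend : AllPairs _≢_ (u ∷ v ∷ a ∷ b ∷ []) → AllPairs _≢_ (u ∷ v ∷ a ∷ b ∷ xs)
    extend ((u≢v ∷ u≢a ∷ u≢b ∷ []) ∷ (v≢a ∷ v≢b ∷ []) ∷ (a≢b ∷ []) ∷ [] ∷ []) =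
      (u≢v ∷ u≢a ∷ u≢b ∷ All.map (λ (x≢u , _) → x≢u ∘ sym) outside) ∷
      (v≢a ∷ v≢b ∷ All.map (λ (_ , x≢v , _) → x≢v ∘ sym) outside) ∷
      (a≢b ∷ All.map (λ (_ , _ , x≢a , _) → x≢a ∘ sym) outside) ∷
      All.map (λ (_ , _ , _ , x≢b) → x≢b ∘ sym) outside ∷ distinct

  apex : ∀ {x} → Outside x → adj H a x ≡ true → adj H b x ≡ true →
         1 ≤ (𝟙 (adj H u b) + 𝟙 (adj H v a)) + (𝟙 (adj H u x) + 𝟙 (adj H v x))
  apex {x} x-out ax bx =
    ≤ᵇ-true⇒≤ 1 _ (by-exhaustion₅ square+apex at-least-one refl (induced H (lookup (u ∷ v ∷ a ∷ b ∷ x ∷ [])))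
                    (P4Sparse-lookup {H = H} (with-square (x-out ∷ []) ([] ∷ [])) sparse)
                    (∧-≡ uv (∧-≡ ua (∧-≡ vb (∧-≡ ab (∧-≡ ax bx))))))
    where
    square+apex at-least-one : Table 5 → Bool
    square+apex t = let e = tableAdj t in e 0F 1F ∧ e 0F 2F ∧ e 1F 3F ∧ e 2F 3F ∧ e 2F 4F ∧ e 3F 4F
    at-least-one t = let e = tableAdj t in 1 ≤ᵇ (𝟙 (e 0F 3F) + 𝟙 (e 1F 2F)) + (𝟙 (e 0F 4F) + 𝟙 (e 1F 4F))

  two-apices : ∀ {x y} → Outside x → Outside y → x ≢ y →
               adj H a x ≡ true → adj H b x ≡ true → adj H a y ≡ true → adj H b y ≡ true →
               2 ≤ (𝟙 (adj H u b) + 𝟙 (adj H v a)) +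
                   ((𝟙 (adj H u x) + 𝟙 (adj H v x)) + (𝟙 (adj H u y) + 𝟙 (adj H v y)))
  two-apices {x} {y} x-out y-out x≢y ax bx ay by =
    ≤ᵇ-true⇒≤ 2 _ (by-exhaustion₆ square+apices at-least-two refl
                    (induced H (lookup (u ∷ v ∷ a ∷ b ∷ x ∷ y ∷ [])))
                    (P4Sparse-lookup {H = H} (with-square (x-out ∷ y-out ∷ []) ((x≢y ∷ []) ∷ [] ∷ [])) sparse)
                    (∧-≡ uv (∧-≡ ua (∧-≡ vb (∧-≡ ab (∧-≡ ax (∧-≡ bx (∧-≡ ay by))))))))
    where
    square+apices at-least-two : Table 6 → Bool
    square+apices t = let e = tableAdj t in
      e 0F 1F ∧ e 0F 2F ∧ e 1F 3F ∧ e 2F 3F ∧ e 2F 4F ∧ e 3F 4F ∧ e 2F 5F ∧ e 3F 5F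
    at-least-two t = let e = tableAdj t in
      2 ≤ᵇ (𝟙 (e 0F 3F) + 𝟙 (e 1F 2F)) + ((𝟙 (e 0F 4F) + 𝟙 (e 1F 4F)) + (𝟙 (e 0F 5F) + 𝟙 (e 1F 5F)))

  apex-with-pendant : ∀ {x y} → Outside x → Outside y → x ≢ y →
                      adj H a x ≡ true → adj H b x ≡ true → adj H x y ≡ true →
                      2 ≤ (𝟙 (adj H u x) + 𝟙 (adj H v x)) +
                          (𝟙 (adj H u y) + (𝟙 (adj H v y) + (𝟙 (adj H a y) + 𝟙 (adj H b y))))
  apex-with-pendant {x} {y} x-out y-out x≢y ax bx xy =
    ≤ᵇ-true⇒≤ 2 _ (by-exhaustion₆ square+apex+pendant at-least-two refl
                    (induced H (lookup (u ∷ v ∷ a ∷ b ∷ x ∷ y ∷ [])))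
                    (P4Sparse-lookup {H = H} (with-square (x-out ∷ y-out ∷ []) ((x≢y ∷ []) ∷ [] ∷ [])) sparse)
                    (∧-≡ uv (∧-≡ ua (∧-≡ vb (∧-≡ ab (∧-≡ ax (∧-≡ bx xy)))))))
    where
    square+apex+pendant at-least-two : Table 6 → Bool
    square+apex+pendant t = let e = tableAdj t in
      e 0F 1F ∧ e 0F 2F ∧ e 1F 3F ∧ e 2F 3F ∧ e 2F 4F ∧ e 3F 4F ∧ e 4F 5F
    at-least-two t = let e = tableAdj t in
      2 ≤ᵇ (𝟙 (e 0F 4F) + 𝟙 (e 1F 4F)) + (𝟙 (e 0F 5F) + (𝟙 (e 1F 5F) + (𝟙 (e 2F 5F) + 𝟙 (e 3F 5F))))

-- Roles, and the role patterns of induced P4s in the completed graph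

data Case : Set where
  none one many : Case

caseOf : ℕ → Case
caseOf zero          = none
caseOf (suc zero)    = one
caseOf (suc (suc _)) = many

bonus : Case → ℕ
bonus none = 0
bonus one  = 1
bonus many = 2

lam-spider : ∀ m r → lam (2 + m) r ≡ 1 + bonus (caseOf r) + 2 * m
lam-spider m zero          = cong (_∸ 3) (*-distribˡ-+ 2 2 m)
lam-spider m (suc zero)    = cong (_∸ 2) (*-distribˡ-+ 2 2 m)
lam-spider m (suc (suc _)) = cong (_∸ 1) (*-distribˡ-+ 2 2 m)

Role : Set
Role = Fin 7

-- U, V, A, B are the single vertices u, v, a = f u, b = f v; S and K are the remaining vertices of
-- S and of K, and R is R.
pattern U = 0F
pattern V = 1F
pattern A = 2F
pattern B = 3F
pattern S = 4F
pattern K = 5F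
pattern R = suc 5F

joins : Case → Role → Role → Bool
joins _    U V = true
joins _    U K = true
joins _    V K = true
joins none U B = false
joins _    U B = true
joins many V A = true
joins _    _ _ = false

newEdge : Case → Role → Role → Bool
newEdge c r s = joins c r s ∨ joins c s r

newEdge-irrefl : ∀ c r → newEdge c r r ≡ false
newEdge-irrefl c U = refl
newEdge-irrefl c V = refl
newEdge-irrefl c A = refl
newEdge-irrefl c B = refl
newEdge-irrefl c S = refl
newEdge-irrefl c K = refl
newEdge-irrefl c R = refl

data Far : Role → Set where
  far-S : Far S
  far-K : Far K
  far-R : Far R

newEdge-far : ∀ c {r s} → Far r → Far s → newEdge c r s ≡ false
newEdge-far c far-S far-S = refl
newEdge-far c far-S far-K = refl
newEdge-far c far-S far-R = refl
newEdge-far c far-K far-S = refl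
newEdge-far c far-K far-K = refl
newEdge-far c far-K far-R = refl
newEdge-far c far-R far-S = refl
newEdge-far c far-R far-K = refl
newEdge-far c far-R far-R = refl

-- What the roles of two distinct vertices say about their adjacency: it is forced, it depends on the
-- vertices, or the two roles cannot be carried by distinct vertices.
data Link : Set where
  forced : Bool → Link
  free identical : Link

avoidsS : Role → Bool
avoidsS U = false
avoidsS V = false
avoidsS S = false
avoidsS _ = true

link : Role → Role → Link
link U U = identical
link V V = identical
link A A = identical
link B B = identical
link S K = free
link K S = free
link R R = free
link U A = forced true
link A U = forced true
link V B = forced true
link B V = forced true
link r s = forced (avoidsS r ∧ avoidsS s)

completedLink : Case → Role → Role → Link
completedLink c r s = if newEdge c r s then forced true else link r s

fits : Bool → Link → Bool
fits β (forced γ) = does (β ≟ᵇ γ)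
fits β free       = true
fits β identical  = false

P4-fits : Case → Role → Role → Role → Role → Bool
P4-fits c r₁ r₂ r₃ r₄ =
  fits true (completedLink c r₁ r₂) ∧ fits true (completedLink c r₂ r₃) ∧ fits true (completedLink c r₃ r₄) ∧
  fits false (completedLink c r₁ r₃) ∧ fits false (completedLink c r₁ r₄) ∧ fits false (completedLink c r₂ r₄)

data RolePattern : Case → Role → Role → Role → Role → Set where
  inside-R : ∀ {c} → RolePattern c R R R R
  matched  : ∀ {c} → RolePattern c S K K S
  pendant  : ∀ {c} → RolePattern c V U A R
  pendant′ : RolePattern none U V B R

rolePattern? : ∀ c r₁ r₂ r₃ r₄ → Maybe (RolePattern c r₁ r₂ r₃ r₄)
rolePattern? _    R R R R = just inside-R
rolePattern? _    S K K S = just matched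
rolePattern? _    V U A R = just pendant
rolePattern? none U V B R = just pendant′
rolePattern? _    _ _ _ _ = nothing

everyFin : ∀ {k} → (Fin k → Bool) → Bool
everyFin {zero}  P = true
everyFin {suc k} P = P zero ∧ everyFin (P ∘ suc)

everyFin-sound : ∀ {k} (P : Fin k → Bool) → everyFin P ≡ true → ∀ i → P i ≡ true
everyFin-sound P holds zero    = proj₁ (∧-≡-split holds)
everyFin-sound P holds (suc i) = everyFin-sound (P ∘ suc) (proj₂ (∧-≡-split holds)) i

FitsPattern : Case → Role → Role → Role → Role → Bool
FitsPattern c r₁ r₂ r₃ r₄ =
  not (P4-fits c r₁ r₂ r₃ r₄) ∨ is-just (rolePattern? c r₁ r₂ r₃ r₄) ∨ is-just (rolePattern? c r₄ r₃ r₂ r₁)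

every-FitsPattern : ∀ c →
  (everyFin λ r₁ → everyFin λ r₂ → everyFin λ r₃ → everyFin λ r₄ → FitsPattern c r₁ r₂ r₃ r₄) ≡ true
every-FitsPattern none = refl
every-FitsPattern one  = refl
every-FitsPattern many = refl

fitsPattern : ∀ c r₁ r₂ r₃ r₄ → FitsPattern c r₁ r₂ r₃ r₄ ≡ true
fitsPattern c r₁ r₂ r₃ r₄ =
  everyFin-sound (FitsPattern c r₁ r₂ r₃) (everyFin-sound (λ r₃ → everyFin (FitsPattern c r₁ r₂ r₃))
    (everyFin-sound (λ r₂ → everyFin λ r₃ → everyFin (FitsPattern c r₁ r₂ r₃))
      (everyFin-sound (λ r₁ → everyFin λ r₂ → everyFin λ r₃ → everyFin (FitsPattern c r₁ r₂ r₃))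
        (every-FitsPattern c) r₁) r₂) r₃) r₄

module Spider {n} (G : Graph n) (spider : ThinSpider G) {u v : Fin n} (u≢v : u ≢ v)
              (u∈S : ThinSpider.part spider u ≡ inS) (v∈S : ThinSpider.part spider v ≡ inS) where
  open ThinSpider spider

  a b : Fin n
  a = f u
  b = f v

  a∈K : part a ≡ inK
  a∈K = f-into u u∈S
  b∈K : part b ≡ inK
  b∈K = f-into v v∈S
  a≢b : a ≢ b
  a≢b = u≢v ∘ f-inj u v u∈S v∈S

  classify : Part → Fin n → Role
  classify inS x = if does (x ≟ u) then U else if does (x ≟ v) then V else S
  classify inK x = if does (x ≟ a) then A else if does (x ≟ b) then B else K
  classify inR x = R

  role : Fin n → Role
  role x = classify (part x) x

  Facts : Role → Fin n → Set
  Facts U x = x ≡ u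
  Facts V x = x ≡ v
  Facts A x = x ≡ a
  Facts B x = x ≡ b
  Facts S x = part x ≡ inS × x ≢ u × x ≢ v
  Facts K x = part x ≡ inK × x ≢ a × x ≢ b
  Facts R x = part x ≡ inR

  role-sound : ∀ x → Facts (role x) x
  role-sound x with part x in x∈
  ... | inS with x ≟ u | x ≟ v
  ...   | yes x≡u | _       = x≡u
  ...   | no  _   | yes x≡v = x≡v
  ...   | no  x≢u | no  x≢v = x∈ , x≢u , x≢v
  role-sound x | inK with x ≟ a | x ≟ b
  ...   | yes x≡a | _       = x≡a
  ...   | no  _   | yes x≡b = x≡b
  ...   | no  x≢a | no  x≢b = x∈ , x≢a , x≢b
  role-sound x | inR = x∈

  role-facts : ∀ {r x} → role x ≡ r → Facts r x
  role-facts {x = x} role-x = subst (λ r → Facts r x) role-x (role-sound x)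

  role-u : role u ≡ U
  role-u = trans (cong (λ p → classify p u) u∈S)
                 (cong (λ d → if d then U else if does (u ≟ v) then V else S) (dec-true (u ≟ u) refl))
  role-v : role v ≡ V
  role-v = trans (cong (λ p → classify p v) v∈S)
                 (cong₂ (λ d e → if d then U else if e then V else S) (dec-false (v ≟ u) (u≢v ∘ sym)) (dec-true (v ≟ v) refl))
  role-a : role a ≡ A
  role-a rewrite a∈K | dec-true (a ≟ a) refl = refl
  role-b : role b ≡ B
  role-b rewrite b∈K | dec-false (b ≟ a) (a≢b ∘ sym) | dec-true (b ≟ b) refl = refl

  role-complete : ∀ {r x} → Facts r x → role x ≡ r
  role-complete {U} refl = role-u
  role-complete {V} refl = role-v
  role-complete {A} refl = role-a
  role-complete {B} refl = role-b
  role-complete {S} {x} (x∈S , x≢u , x≢v) rewrite x∈S | dec-false (x ≟ u) x≢u | dec-false (x ≟ v) x≢v = refl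
  role-complete {K} {x} (x∈K , x≢a , x≢b) rewrite x∈K | dec-false (x ≟ a) x≢a | dec-false (x ≟ b) x≢b = refl
  role-complete {R} {x} x∈R rewrite x∈R = refl

  role-≢ : ∀ {x y r s} → role x ≡ r → role y ≡ s → r ≢ s → x ≢ y
  role-≢ role-x role-y r≢s refl = r≢s (trans (sym role-x) role-y)

  is : Role → Fin n → Bool
  is r x = does (role x ≟ r)

  is-true : ∀ {r x} → role x ≡ r → is r x ≡ true
  is-true {r} refl = dec-true (r ≟ r) refl

  is⇒role : ∀ {r x} → is r x ≡ true → role x ≡ r
  is⇒role {r} {x} is-r with role x ≟ r
  ... | yes role≡r = role≡r

  is-sound : ∀ {r x} → is r x ≡ true → Facts r x
  is-sound = role-facts ∘ is⇒role

  others : (Fin n → ℕ) → ℕ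
  others h = sumOn (is S) h + (sumOn (is K) h + sumOn (is R) h)

  sum-by-role : ∀ h → sum h ≡ h u + (h v + (h a + (h b + others h)))
  sum-by-role h = begin
    sum h                                              ≡⟨ sum-cong-≗ (λ x → sym (trans (sum-single _ (role x) (off x)) (on x))) ⟩
    sum (λ x → sum (λ r → if is r x then h x else 0)) ≡⟨ ∑-comm {n} {7} (λ x r → if is r x then h x else 0) ⟩
    sum (λ r → sumOn (is r) h)                         ≡⟨ cong₂ _+_ (single U role-u id) (cong₂ _+_ (single V role-v id)
                                                            (cong₂ _+_ (single A role-a id) (cong₂ _+_ (single B role-b id)
                                                              (cong (λ t → sumOn (is S) h + (sumOn (is K) h + t))
                                                                    (+-identityʳ _))))) ⟩
    h u + (h v + (h a + (h b + others h)))             ∎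
    where
    open ≡-Reasoning
    on : ∀ x → (if is (role x) x then h x else 0) ≡ h x
    on x = cong (if_then h x else 0) (dec-true (role x ≟ role x) refl)
    off : ∀ x r → r ≢ role x → (if is r x then h x else 0) ≡ 0
    off x r r≢ rewrite dec-false (role x ≟ r) (r≢ ∘ sym) = refl
    single : ∀ r {x₀} → role x₀ ≡ r → (∀ {x} → Facts r x → x ≡ x₀) → sumOn (is r) h ≡ h x₀
    single r {x₀} role-x₀ unique = trans (sum-single _ x₀ elsewhere) (cong (if_then h x₀ else 0) (is-true role-x₀))
      where
      elsewhere : ∀ x → x ≢ x₀ → (if is r x then h x else 0) ≡ 0
      elsewhere x x≢x₀ with is r x in is-r-x
      ... | true  = ⊥-elim (x≢x₀ (unique (is-sound is-r-x)))
      ... | false = refl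

  others-mono-≤ : ∀ {f g : Fin n → ℕ} → (∀ x → f x ≤ g x) → others f ≤ others g
  others-mono-≤ {f} {g} f≤g = +-mono-≤ (on (is S)) (+-mono-≤ (on (is K)) (on (is R)))
    where
    on : ∀ p → sumOn p f ≤ sumOn p g
    on p = sumOn-mono-≤ p λ x _ → f≤g x

  others-cong : ∀ {f g : Fin n → ℕ} → (∀ x → Far (role x) → f x ≡ g x) → others f ≡ others g
  others-cong f≡g = cong₂ _+_ (on far-S) (cong₂ _+_ (on far-K) (on far-R))
    where
    on : ∀ {r} → Far r → sumOn (is r) _ ≡ sumOn (is r) _
    on far-r = sumOn-cong (is _) λ x is-r → f≡g x (subst Far (sym (is⇒role is-r)) far-r)

  others-0 : others (λ _ → 0) ≡ 0
  others-0 = cong₂ _+_ (sumOn-const (is S) 0) (cong₂ _+_ (sumOn-const (is K) 0) (sumOn-const (is R) 0))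

  size-of : ∀ p → count (λ x → isPart (part x) p)
            ≡ 𝟙 (isPart inS p) + (𝟙 (isPart inS p) + (𝟙 (isPart inK p) + (𝟙 (isPart inK p) +
              (𝟙 (isPart inS p) * count (is S) + (𝟙 (isPart inK p) * count (is K) + 𝟙 (isPart inR p) * count (is R))))))
  size-of p = begin
    count (λ x → isPart (part x) p)         ≡⟨ count≡sum (λ x → isPart (part x) p) ⟩
    sum h                                   ≡⟨ sum-by-role h ⟩
    h u + (h v + (h a + (h b + others h)))  ≡⟨ cong₂ _+_ (at u∈S) (cong₂ _+_ (at v∈S) (cong₂ _+_ (at a∈K) (cong₂ _+_ (at b∈K)
                                                 (cong₂ _+_ (on S proj₁) (cong₂ _+_ (on K proj₁) (on R id)))))) ⟩
    _                                       ∎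
    where
    open ≡-Reasoning
    h : Fin n → ℕ
    h x = 𝟙 (isPart (part x) p)
    at : ∀ {x q} → part x ≡ q → h x ≡ 𝟙 (isPart q p)
    at x∈q = cong (λ q → 𝟙 (isPart q p)) x∈q
    on : ∀ r {q} → (∀ {x} → Facts r x → part x ≡ q) → sumOn (is r) h ≡ 𝟙 (isPart q p) * count (is r)
    on r part-r = trans (sumOn-cong (is r) λ x is-r → at (part-r (is-sound is-r))) (sumOn-const (is r) _)

  sizeK≡ : sizeK ≡ 2 + count (is K)
  sizeK≡ = trans (size-of inK) (cong (2 +_) (trans (+-identityʳ _) (+-identityʳ _)))

  sizeR≡ : sizeR ≡ count (is R)
  sizeR≡ = trans (size-of inR) (+-identityʳ _)

  #S≡#K : count (is S) ≡ count (is K)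
  #S≡#K = +-cancelˡ-≡ 2 _ _ (trans (sym sizeS≡) (trans S≡K sizeK≡))
    where
    sizeS≡ : count (λ x → isPart (part x) inS) ≡ 2 + count (is S)
    sizeS≡ = trans (size-of inS) (cong (2 +_) (trans (+-identityʳ _) (+-identityʳ _)))

  part-≢ : ∀ {x y p q} → part x ≡ p → part y ≡ q → p ≢ q → x ≢ y
  part-≢ x∈p y∈q p≢q refl = p≢q (trans (sym x∈p) y∈q)

  S≢K : ∀ {x y} → part x ≡ inS → part y ≡ inK → x ≢ y
  S≢K x∈S y∈K = part-≢ x∈S y∈K λ ()
  S≢R : ∀ {x y} → part x ≡ inS → part y ≡ inR → x ≢ y
  S≢R x∈S y∈R = part-≢ x∈S y∈R λ ()
  K≢R : ∀ {x y} → part x ≡ inK → part y ≡ inR → x ≢ y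
  K≢R x∈K y∈R = part-≢ x∈K y∈R λ ()

  f-≢ : ∀ {s t} → part s ≡ inS → part t ≡ inS → s ≢ t → f s ≢ f t
  f-≢ {s} {t} s∈S t∈S s≢t = s≢t ∘ f-inj s t s∈S t∈S

  square-distinct : AllPairs _≢_ (u ∷ v ∷ a ∷ b ∷ [])
  square-distinct =
    (u≢v ∷ S≢K u∈S a∈K ∷ S≢K u∈S b∈K ∷ []) ∷ (S≢K v∈S a∈K ∷ S≢K v∈S b∈K ∷ []) ∷ (a≢b ∷ []) ∷ [] ∷ []

  outside-square : ∀ {r x} → Far r → Facts r x → x ≢ u × x ≢ v × x ≢ a × x ≢ b
  outside-square far-S (x∈S , x≢u , x≢v) = x≢u , x≢v , S≢K x∈S a∈K , S≢K x∈S b∈K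
  outside-square far-K (x∈K , x≢a , x≢b) = S≢K u∈S x∈K ∘ sym , S≢K v∈S x∈K ∘ sym , x≢a , x≢b
  outside-square far-R x∈R = S≢R u∈S x∈R ∘ sym , S≢R v∈S x∈R ∘ sym , K≢R a∈K x∈R ∘ sym , K≢R b∈K x∈R ∘ sym

  not-partner : ∀ {s k} → part s ≡ inS → part k ≡ inK → k ≢ f s → adj G s k ≡ false
  not-partner {s} {k} s∈S k∈K k≢fs with adj G s k in sk
  ... | true  = ⊥-elim (k≢fs (proj₁ (S-nbhd s k s∈S k∈K) sk))
  ... | false = refl

  partner : ∀ {s} → part s ≡ inS → adj G s (f s) ≡ true
  partner {s} s∈S = proj₂ (S-nbhd s (f s) s∈S (f-into s s∈S)) refl

  flip : ∀ {x y β} → adj G x y ≡ β → adj G y x ≡ β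
  flip {x} {y} = trans (Graph.sym G y x)

  u-a : adj G u a ≡ true
  u-a = partner u∈S
  v-b : adj G v b ≡ true
  v-b = partner v∈S
  a-b : adj G a b ≡ true
  a-b = K-clique a b a∈K b∈K a≢b
  u-b : adj G u b ≡ false
  u-b = not-partner u∈S b∈K (a≢b ∘ sym)
  v-a : adj G v a ≡ false
  v-a = not-partner v∈S a∈K a≢b
  u-v : adj G u v ≡ false
  u-v = S-indep u v u∈S v∈S

  S-adjacencies : ∀ {x} → Facts S x →
                  adj G u x ≡ false × adj G v x ≡ false × adj G a x ≡ false × adj G b x ≡ false
  S-adjacencies {x} (x∈S , x≢u , x≢v) =
    S-indep u x u∈S x∈S , S-indep v x v∈S x∈S ,
    flip (not-partner x∈S a∈K (f-≢ x∈S u∈S x≢u ∘ sym)) , flip (not-partner x∈S b∈K (f-≢ x∈S v∈S x≢v ∘ sym))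

  K-adjacencies : ∀ {x} → Facts K x →
                  adj G u x ≡ false × adj G v x ≡ false × adj G a x ≡ true × adj G b x ≡ true
  K-adjacencies (x∈K , x≢a , x≢b) =
    not-partner u∈S x∈K x≢a , not-partner v∈S x∈K x≢b ,
    K-clique a _ a∈K x∈K (x≢a ∘ sym) , K-clique b _ b∈K x∈K (x≢b ∘ sym)

  R-adjacencies : ∀ {x} → Facts R x →
                  adj G u x ≡ false × adj G v x ≡ false × adj G a x ≡ true × adj G b x ≡ true
  R-adjacencies {x} x∈R =
    flip (R-S x u x∈R u∈S) , flip (R-S x v x∈R v∈S) , flip (R-K x a x∈R a∈K) , flip (R-K x b x∈R b∈K)

  -- Counting the fill edges of any supergraph of G containing uv

  module Supergraph (H′ : Graph n) (G⊆H′ : ∀ i j → adj G i j ≡ true → adj H′ i j ≡ true)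
                    (uv∈H′ : adj H′ u v ≡ true) where

    F : Fin n → Fin n → ℕ
    F x y = 𝟙 (fill G H′ x y)

    deg : Fin n → ℕ
    deg x = count (fill G H′ x)

    L : Fin n → ℕ
    L x = F u x + (F v x + (F a x + F b x))

    W : ℕ
    W = 𝟙 (adj H′ u b) + 𝟙 (adj H′ v a)

    F-on-edge : ∀ {x y} → adj G x y ≡ true → F x y ≡ 0
    F-on-edge xy∈G = cong 𝟙 (fill-on-edge {G = G} {H = H′} xy∈G)

    F-off-edge : ∀ {x y} → adj G x y ≡ false → F x y ≡ 𝟙 (adj H′ x y)
    F-off-edge xy∉G = cong 𝟙 (fill-off-edge {G = G} {H = H′} xy∉G)

    F-self : ∀ x → F x x ≡ 0
    F-self x = cong 𝟙 (fill-irrefl G H′ x)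

    F-sym : ∀ x y → F x y ≡ F y x
    F-sym x y = cong 𝟙 (fill-sym G H′ x y)

    F-swap : ∀ {x y β} → adj G y x ≡ false → adj H′ y x ≡ β → F x y ≡ 𝟙 β
    F-swap {x} {y} yx∉G yx = trans (F-off-edge (flip yx∉G)) (cong 𝟙 (trans (Graph.sym H′ x y) yx))

    L-at-square : L u + (L v + (L a + L b)) ≡ (1 + W) + (1 + W)
    L-at-square = begin
      L u + (L v + (L a + L b))          ≡⟨ cong₂ _+_ Lu (cong₂ _+_ Lv (cong₂ _+_ La Lb)) ⟩
      (1 + ub) + ((1 + va) + (va + ub))  ≡⟨ solve 2 (λ ub va → (con 1 :+ ub) :+ ((con 1 :+ va) :+ (va :+ ub))
                                                            := (con 1 :+ (ub :+ va)) :+ (con 1 :+ (ub :+ va))) refl ub va ⟩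
      (1 + W) + (1 + W)                  ∎
      where
      open ≡-Reasoning
      ub va : ℕ
      ub = 𝟙 (adj H′ u b)
      va = 𝟙 (adj H′ v a)
      Lu : L u ≡ 1 + ub
      Lu = cong₂ _+_ (F-self u) (cong₂ _+_ (F-swap u-v uv∈H′) (cong₂ _+_ (F-on-edge (flip u-a)) (F-swap u-b refl)))
      Lv : L v ≡ 1 + va
      Lv = trans (cong₂ _+_ (F-off-edge u-v) (cong₂ _+_ (F-self v) (cong₂ _+_ (F-swap v-a refl) (F-on-edge (flip v-b)))))
                 (cong₂ _+_ (cong 𝟙 uv∈H′) (+-identityʳ va))
      La : L a ≡ va
      La = trans (cong₂ _+_ (F-on-edge u-a) (cong₂ _+_ (F-off-edge v-a) (cong₂ _+_ (F-self a) (F-on-edge (flip a-b)))))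
                 (+-identityʳ va)
      Lb : L b ≡ ub
      Lb = trans (cong₂ _+_ (F-off-edge u-b) (cong₂ _+_ (F-on-edge v-b) (cong₂ _+_ (F-on-edge a-b) (F-self b))))
                 (+-identityʳ ub)

    column-sum : sum L ≡ deg u + (deg v + (deg a + deg b))
    column-sum = begin
      sum L                                                ≡⟨ ∑-distrib-+ {n} (F u) _ ⟩
      sum (F u) + sum (λ x → F v x + (F a x + F b x))      ≡⟨ cong (sum (F u) +_) (∑-distrib-+ {n} (F v) _) ⟩
      sum (F u) + (sum (F v) + sum (λ x → F a x + F b x))  ≡⟨ cong (λ t → sum (F u) + (sum (F v) + t))
                                                                  (∑-distrib-+ {n} (F a) (F b)) ⟩
      sum (F u) + (sum (F v) + (sum (F a) + sum (F b)))    ≡⟨ cong₂ _+_ (row u) (cong₂ _+_ (row v)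
                                                                  (cong₂ _+_ (row a) (row b))) ⟨
      deg u + (deg v + (deg a + deg b))                    ∎
      where
      open ≡-Reasoning
      row : ∀ x → deg x ≡ sum (F x)
      row x = count≡sum (fill G H′ x)

    fill-identity : fillCount G H′ + fillCount G H′ ≡ (1 + W) + (1 + W) + others L + others deg
    fill-identity = begin
      fillCount G H′ + fillCount G H′                      ≡⟨ fillCount-handshake G H′ ⟩
      sum deg                                              ≡⟨ sum-by-role deg ⟩
      deg u + (deg v + (deg a + (deg b + others deg)))     ≡⟨ regroup (deg u) (deg v) (deg a) (deg b) (others deg) ⟩
      deg u + (deg v + (deg a + deg b)) + others deg       ≡⟨ cong (_+ others deg) column-sum ⟨
      sum L + others deg                                   ≡⟨ cong (_+ others deg) (sum-by-role L) ⟩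
      L u + (L v + (L a + (L b + others L))) + others deg  ≡⟨ cong (_+ others deg) (regroup (L u) (L v) (L a) (L b) (others L)) ⟩
      L u + (L v + (L a + L b)) + others L + others deg    ≡⟨ cong (λ t → t + others L + others deg) L-at-square ⟩
      (1 + W) + (1 + W) + others L + others deg            ∎
      where open ≡-Reasoning

    deg-split : ∀ x → deg x ≡ L x + others (F x)
    deg-split x = begin
      deg x                                               ≡⟨ count≡sum (fill G H′ x) ⟩
      sum (F x)                                           ≡⟨ sum-by-role (F x) ⟩
      F x u + (F x v + (F x a + (F x b + others (F x))))  ≡⟨ regroup (F x u) (F x v) (F x a) (F x b) (others (F x)) ⟩
      F x u + (F x v + (F x a + F x b)) + others (F x)    ≡⟨ cong (_+ others (F x)) (cong₂ _+_ (F-sym x u)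
                                                               (cong₂ _+_ (F-sym x v) (cong₂ _+_ (F-sym x a) (F-sym x b)))) ⟩
      L x + others (F x)                                  ∎
      where open ≡-Reasoning

    L-beside-square : ∀ {x} → adj G u x ≡ false × adj G v x ≡ false × adj G a x ≡ true × adj G b x ≡ true →
                      L x ≡ 𝟙 (adj H′ u x) + 𝟙 (adj H′ v x)
    L-beside-square (ux , vx , ax , bx) =
      trans (cong₂ _+_ (F-off-edge ux) (cong₂ _+_ (F-off-edge vx) (cong₂ _+_ (F-on-edge ax) (F-on-edge bx))))
            (cong (𝟙 (adj H′ u _) +_) (+-identityʳ _))

    L-of-S : ∀ {x} → Facts S x → L x ≡ 𝟙 (adj H′ u x) + (𝟙 (adj H′ v x) + (𝟙 (adj H′ a x) + 𝟙 (adj H′ b x)))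
    L-of-S x∈S = let ux , vx , ax , bx = S-adjacencies x∈S in
      cong₂ _+_ (F-off-edge ux) (cong₂ _+_ (F-off-edge vx) (cong₂ _+_ (F-off-edge ax) (F-off-edge bx)))

    fillCount-≥ : 1 + W + others L ≤ fillCount G H′
    fillCount-≥ = half-≤ _ _ (begin
      (1 + W + others L) + (1 + W + others L)    ≡⟨ solve 2 (λ w l → (con 1 :+ w :+ l) :+ (con 1 :+ w :+ l)
                                                       := (con 1 :+ w) :+ (con 1 :+ w) :+ l :+ l) refl W (others L) ⟩
      (1 + W) + (1 + W) + others L + others L    ≤⟨ +-monoʳ-≤ ((1 + W) + (1 + W) + others L)
                                                      (others-mono-≤ λ x → subst (L x ≤_) (sym (deg-split x)) (m≤m+n _ _)) ⟩
      (1 + W) + (1 + W) + others L + others deg  ≡⟨ fill-identity ⟨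
      fillCount G H′ + fillCount G H′            ∎)
      where open ≤-Reasoning

    module LowerBound (sparse : P4Sparse H′) where
      open Square {H = H′} sparse square-distinct uv∈H′ (G⊆H′ _ _ u-a) (G⊆H′ _ _ v-b) (G⊆H′ _ _ a-b)

      partner-pair-≥ : ∀ {s} → Facts S s → 2 ≤ L (f s) + L s
      partner-pair-≥ {s} s∈S′@(s∈S , s≢u , s≢v) =
        let _ , _ , ax , bx = K-adjacencies fs∈K′ in
        subst (2 ≤_) (sym (cong₂ _+_ (L-beside-square (K-adjacencies fs∈K′)) (L-of-S s∈S′)))
          (apex-with-pendant (outside-square far-K fs∈K′) (outside-square far-S s∈S′) (S≢K s∈S fs∈K ∘ sym)
                             (G⊆H′ _ _ ax) (G⊆H′ _ _ bx) (G⊆H′ _ _ (flip (partner s∈S))))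
        where
        fs∈K : part (f s) ≡ inK
        fs∈K = f-into s s∈S
        fs∈K′ : Facts K (f s)
        fs∈K′ = fs∈K , f-≢ s∈S u∈S s≢u , f-≢ s∈S v∈S s≢v

      partner-pairs-≥ : 2 * count (is K) ≤ sumOn (is S) L + sumOn (is K) L
      partner-pairs-≥ = begin
        2 * count (is K)                       ≡⟨ cong (2 *_) #S≡#K ⟨
        2 * count (is S)                       ≡⟨ sumOn-const (is S) 2 ⟨
        sumOn (is S) (λ _ → 2)                 ≤⟨ sumOn-mono-≤ (is S) (λ s is-S →
                                                    subst (2 ≤_) (+-comm (L (f s)) (L s)) (partner-pair-≥ (is-sound is-S))) ⟩
        sumOn (is S) (λ s → L s + L (f s))     ≡⟨ sumOn-+ (is S) L (L ∘ f) ⟩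
        sumOn (is S) L + sumOn (is S) (L ∘ f)  ≤⟨ +-monoʳ-≤ (sumOn (is S) L) (sumOn-injection (is S) (is K) f L S→K injective) ⟩
        sumOn (is S) L + sumOn (is K) L        ∎
        where
        open ≤-Reasoning
        S→K : ∀ s → is S s ≡ true → is K (f s) ≡ true
        S→K s is-S = let s∈S , s≢u , s≢v = is-sound is-S in
          is-true (role-complete {K} (f-into s s∈S , f-≢ s∈S u∈S s≢u , f-≢ s∈S v∈S s≢v))
        injective : ∀ s t → is S s ≡ true → is S t ≡ true → f s ≡ f t → s ≡ t
        injective s t is-S is-S′ = f-inj s t (proj₁ (is-sound is-S)) (proj₁ (is-sound is-S′))

      one-R-≥ : ∀ {r} → Facts R r → 1 ≤ W + L r
      one-R-≥ {r} r∈R = let _ , _ , ar , br = R-adjacencies r∈R in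
        subst (λ l → 1 ≤ W + l) (sym (L-beside-square (R-adjacencies r∈R)))
          (apex (outside-square far-R r∈R) (G⊆H′ _ _ ar) (G⊆H′ _ _ br))

      two-R-≥ : ∀ {r t} → Facts R r → Facts R t → r ≢ t → 2 ≤ W + (L r + L t)
      two-R-≥ {r} {t} r∈R t∈R r≢t =
        let _ , _ , ar , br = R-adjacencies r∈R ; _ , _ , at , bt = R-adjacencies t∈R in
        subst (λ l → 2 ≤ W + l) (sym (cong₂ _+_ (L-beside-square (R-adjacencies r∈R)) (L-beside-square (R-adjacencies t∈R))))
          (two-apices (outside-square far-R r∈R) (outside-square far-R t∈R) r≢t
                      (G⊆H′ _ _ ar) (G⊆H′ _ _ br) (G⊆H′ _ _ at) (G⊆H′ _ _ bt))

      R-≥ : bonus (caseOf (count (is R))) ≤ W + sumOn (is R) L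
      R-≥ with count (is R) in #R
      ... | zero = z≤n
      ... | suc zero with count-witness (is R) (≤-reflexive (sym #R))
      ...   | r , is-R = ≤-trans (one-R-≥ (is-sound is-R)) (+-monoʳ-≤ W (sumOn-point L is-R))
      R-≥ | suc (suc _) with count-two-witnesses (is R) (≤-trans (s≤s (s≤s z≤n)) (≤-reflexive (sym #R)))
      ...   | r , t , r≢t , is-R , is-R′ =
        ≤-trans (two-R-≥ (is-sound is-R) (is-sound is-R′) r≢t) (+-monoʳ-≤ W (sumOn-two-points L r≢t is-R is-R′))

      fillCount-lower-bound : 1 + bonus (caseOf (count (is R))) + 2 * count (is K) ≤ fillCount G H′
      fillCount-lower-bound = begin
        1 + bonus (caseOf (count (is R))) + 2 * count (is K)  ≤⟨ +-mono-≤ (s≤s R-≥) partner-pairs-≥ ⟩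
        1 + (W + sR) + (sS + sK)                              ≡⟨ solve 4 (λ w sS sK sR → con 1 :+ (w :+ sR) :+ (sS :+ sK)
                                                                  := con 1 :+ w :+ (sS :+ (sK :+ sR))) refl W sS sK sR ⟩
        1 + W + others L                                      ≤⟨ fillCount-≥ ⟩
        fillCount G H′                                        ∎
        where
        open ≤-Reasoning
        sS sK sR : ℕ
        sS = sumOn (is S) L
        sK = sumOn (is K) L
        sR = sumOn (is R) L

  -- The completion and its number of fill edges

  completion : Case → Graph n
  completion c = record
    { adj    = λ x y → adj G x y ∨ newEdge c (role x) (role y)
    ; sym    = λ x y → cong₂ _∨_ (Graph.sym G x y) (∨-comm (joins c (role x) (role y)) (joins c (role y) (role x)))
    ; irrefl = λ x → cong₂ _∨_ (Graph.irrefl G x) (newEdge-irrefl c (role x))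
    }

  G⊆completion : ∀ c i j → adj G i j ≡ true → adj (completion c) i j ≡ true
  G⊆completion c i j ij∈G = cong (_∨ newEdge c (role i) (role j)) ij∈G

  completion-adj : ∀ c {x y r s} → role x ≡ r → role y ≡ s → adj (completion c) x y ≡ adj G x y ∨ newEdge c r s
  completion-adj c refl refl = refl

  uv∈completion : ∀ c → adj (completion c) u v ≡ true
  uv∈completion c = trans (completion-adj c role-u role-v) (∨-zeroʳ (adj G u v))

  module Completion (c : Case) where
    open Supergraph (completion c) (G⊆completion c) (uv∈completion c)

    W≡bonus : W ≡ bonus c
    W≡bonus = trans (cong₂ _+_ (cong 𝟙 (trans (completion-adj c role-u role-b) (cong (_∨ newEdge c U B) u-b)))
                               (cong 𝟙 (trans (completion-adj c role-v role-a) (cong (_∨ newEdge c V A) v-a))))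
                    (by-case c)
      where
      by-case : ∀ c → 𝟙 (newEdge c U B) + 𝟙 (newEdge c V A) ≡ bonus c
      by-case none = refl
      by-case one  = refl
      by-case many = refl

    no-far-fill : ∀ {x y} → Far (role x) → Far (role y) → F x y ≡ 0
    no-far-fill {x} {y} far-x far-y =
      cong 𝟙 (trans (cong (λ e → (adj G x y ∨ e) ∧ not (adj G x y)) (newEdge-far c far-x far-y)) (contradictory (adj G x y)))
      where
      contradictory : ∀ g → (g ∨ false) ∧ not g ≡ false
      contradictory true  = refl
      contradictory false = refl

    others-deg≡others-L : others deg ≡ others L
    others-deg≡others-L = others-cong λ x far-x →
      trans (deg-split x) (trans (cong (L x +_) (trans (others-cong (λ y far-y → no-far-fill far-x far-y)) others-0))
                                 (+-identityʳ (L x)))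

    others-L : others L ≡ 2 * count (is K)
    others-L = trans (cong₂ _+_ (class far-S) (cong₂ _+_ (class far-K) (class far-R))) (+-identityʳ _)
      where
      absent : ∀ {q x r s} → role q ≡ r → role x ≡ s → adj G q x ≡ false → newEdge c r s ≡ false →
               𝟙 (adj (completion c) q x) ≡ 0
      absent role-q role-x qx∉G qx-old = cong 𝟙 (trans (completion-adj c role-q role-x) (cong₂ _∨_ qx∉G qx-old))
      present : ∀ {q x r s} → role q ≡ r → role x ≡ s → newEdge c r s ≡ true → 𝟙 (adj (completion c) q x) ≡ 1
      present {q} {x} role-q role-x qx-new =
        cong 𝟙 (trans (completion-adj c role-q role-x) (trans (cong (adj G q x ∨_) qx-new) (∨-zeroʳ (adj G q x))))
      L-value : ∀ {x} r → role x ≡ r → Far r → L x ≡ (if does (r ≟ K) then 2 else 0)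
      L-value S role-x far-S =
        let ux , vx , ax , bx = S-adjacencies (role-facts role-x) in
        trans (L-of-S (role-facts role-x)) (cong₂ _+_ (absent role-u role-x ux refl) (cong₂ _+_ (absent role-v role-x vx refl)
                                             (cong₂ _+_ (absent role-a role-x ax refl) (absent role-b role-x bx refl))))
      L-value K role-x far-K =
        trans (L-beside-square (K-adjacencies (role-facts role-x)))
              (cong₂ _+_ (present role-u role-x refl) (present role-v role-x refl))
      L-value R role-x far-R =
        let ux , vx , _ = R-adjacencies (role-facts role-x) in
        trans (L-beside-square (R-adjacencies (role-facts role-x)))
              (cong₂ _+_ (absent role-u role-x ux refl) (absent role-v role-x vx refl))
      class : ∀ {r} → Far r → sumOn (is r) L ≡ (if does (r ≟ K) then 2 else 0) * count (is r)
      class {r} far-r = trans (sumOn-cong (is r) λ x is-r → L-value r (is⇒role is-r) far-r) (sumOn-const (is r) _)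

    completion-fill : fillCount G (completion c) ≡ 1 + bonus c + 2 * count (is K)
    completion-fill = double-injective _ _ (begin
      fillCount G (completion c) + fillCount G (completion c)  ≡⟨ fill-identity ⟩
      (1 + W) + (1 + W) + others L + others deg                ≡⟨ cong (λ d → (1 + W) + (1 + W) + others L + d)
                                                                       others-deg≡others-L ⟩
      (1 + W) + (1 + W) + others L + others L                  ≡⟨ cong₂ (λ w l → (1 + w) + (1 + w) + l + l) W≡bonus others-L ⟩
      (1 + bonus c) + (1 + bonus c) + 2m + 2m                  ≡⟨ solve 2 (λ β m → (con 1 :+ β) :+ (con 1 :+ β) :+ m :+ m
                                                                   := (con 1 :+ β :+ m) :+ (con 1 :+ β :+ m)) refl (bonus c) 2m ⟩
      (1 + bonus c + 2m) + (1 + bonus c + 2m)                  ∎)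
      where
      open ≡-Reasoning
      2m : ℕ
      2m = 2 * count (is K)

  -- The induced P4s of the completion

  Consistent : Link → Fin n → Fin n → Set
  Consistent (forced β) x y = adj G x y ≡ β
  Consistent free       x y = ⊤
  Consistent identical  x y = ⊥

  consistent : ∀ r s {x y} → Facts r x → Facts s y → x ≢ y → Consistent (link r s) x y
  consistent U U refl refl x≢x = x≢x refl
  consistent U V refl refl _ = u-v
  consistent U A refl refl _ = u-a
  consistent U B refl refl _ = u-b
  consistent U S refl y∈ _ = let e , _ = S-adjacencies y∈ in e
  consistent U K refl y∈ _ = let e , _ = K-adjacencies y∈ in e
  consistent U R refl y∈ _ = let e , _ = R-adjacencies y∈ in e
  consistent V U refl refl _ = flip u-v
  consistent V V refl refl x≢x = x≢x refl
  consistent V A refl refl _ = v-a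
  consistent V B refl refl _ = v-b
  consistent V S refl y∈ _ = let _ , e , _ = S-adjacencies y∈ in e
  consistent V K refl y∈ _ = let _ , e , _ = K-adjacencies y∈ in e
  consistent V R refl y∈ _ = let _ , e , _ = R-adjacencies y∈ in e
  consistent A U refl refl _ = flip u-a
  consistent A V refl refl _ = flip v-a
  consistent A A refl refl x≢x = x≢x refl
  consistent A B refl refl _ = a-b
  consistent A S refl y∈ _ = let _ , _ , e , _ = S-adjacencies y∈ in e
  consistent A K refl y∈ _ = let _ , _ , e , _ = K-adjacencies y∈ in e
  consistent A R refl y∈ _ = let _ , _ , e , _ = R-adjacencies y∈ in e
  consistent B U refl refl _ = flip u-b
  consistent B V refl refl _ = flip v-b
  consistent B A refl refl _ = flip a-b
  consistent B B refl refl x≢x = x≢x refl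
  consistent B S refl y∈ _ = let _ , _ , _ , e = S-adjacencies y∈ in e
  consistent B K refl y∈ _ = let _ , _ , _ , e = K-adjacencies y∈ in e
  consistent B R refl y∈ _ = let _ , _ , _ , e = R-adjacencies y∈ in e
  consistent S U x∈ refl _ = let e , _ = S-adjacencies x∈ in flip e
  consistent S V x∈ refl _ = let _ , e , _ = S-adjacencies x∈ in flip e
  consistent S A x∈ refl _ = let _ , _ , e , _ = S-adjacencies x∈ in flip e
  consistent S B x∈ refl _ = let _ , _ , _ , e = S-adjacencies x∈ in flip e
  consistent S S x∈ y∈ _ = S-indep _ _ (proj₁ x∈) (proj₁ y∈)
  consistent S K x∈ y∈ _ = tt
  consistent S R x∈ y∈ _ = flip (R-S _ _ y∈ (proj₁ x∈))
  consistent K U x∈ refl _ = let e , _ = K-adjacencies x∈ in flip e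
  consistent K V x∈ refl _ = let _ , e , _ = K-adjacencies x∈ in flip e
  consistent K A x∈ refl _ = let _ , _ , e , _ = K-adjacencies x∈ in flip e
  consistent K B x∈ refl _ = let _ , _ , _ , e = K-adjacencies x∈ in flip e
  consistent K S x∈ y∈ _ = tt
  consistent K K x∈ y∈ x≢y = K-clique _ _ (proj₁ x∈) (proj₁ y∈) x≢y
  consistent K R x∈ y∈ _ = flip (R-K _ _ y∈ (proj₁ x∈))
  consistent R U x∈ refl _ = let e , _ = R-adjacencies x∈ in flip e
  consistent R V x∈ refl _ = let _ , e , _ = R-adjacencies x∈ in flip e
  consistent R A x∈ refl _ = let _ , _ , e , _ = R-adjacencies x∈ in flip e
  consistent R B x∈ refl _ = let _ , _ , _ , e = R-adjacencies x∈ in flip e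
  consistent R S x∈ y∈ _ = R-S _ _ x∈ (proj₁ y∈)
  consistent R K x∈ y∈ _ = R-K _ _ x∈ (proj₁ y∈)
  consistent R R x∈ y∈ _ = tt

  pair-fits : ∀ c {x y β} → x ≢ y → adj (completion c) x y ≡ β → fits β (completedLink c (role x) (role y)) ≡ true
  pair-fits c {x} {y} {β} x≢y xy = by-cases (newEdge c (role x) (role y)) refl (link (role x) (role y)) refl
    where
    in-G : Consistent (link (role x) (role y)) x y
    in-G = consistent (role x) (role y) (role-sound x) (role-sound y) x≢y
    by-cases : ∀ e → newEdge c (role x) (role y) ≡ e → ∀ l → link (role x) (role y) ≡ l →
               fits β (if e then forced true else l) ≡ true
    by-cases true  new _ _ =
      dec-true (β ≟ᵇ true) (trans (sym xy) (trans (cong (adj G x y ∨_) new) (∨-zeroʳ (adj G x y))))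
    by-cases false new (forced γ) lk =
      dec-true (β ≟ᵇ γ) (trans (sym xy) (trans (cong (adj G x y ∨_) new)
                                                (trans (∨-identityʳ (adj G x y)) (subst (λ l → Consistent l x y) lk in-G))))
    by-cases false new free      _  = refl
    by-cases false new identical lk = ⊥-elim (subst (λ l → Consistent l x y) lk in-G)

  role-pattern : ∀ c {w x y z} → InducedP4 (completion c) w x y z →
                 RolePattern c (role w) (role x) (role y) (role z) ⊎ RolePattern c (role z) (role y) (role x) (role w)
  role-pattern c {w} {x} {y} {z} ((wx , wy , wz , xy , xz , yz) , (wx∈ , xy∈ , yz∈) , (wy∉ , wz∉ , xz∉)) =
    either (rolePattern? c (role w) (role x) (role y) (role z)) (rolePattern? c (role z) (role y) (role x) (role w))
      (subst (λ p → not p ∨ (is-just (rolePattern? c (role w) (role x) (role y) (role z)) ∨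
                                is-just (rolePattern? c (role z) (role y) (role x) (role w))) ≡ true)
             fitting (fitsPattern c (role w) (role x) (role y) (role z)))
    where
    fitting : P4-fits c (role w) (role x) (role y) (role z) ≡ true
    fitting = ∧-≡ (pair-fits c wx wx∈) (∧-≡ (pair-fits c xy xy∈) (∧-≡ (pair-fits c yz yz∈)
                (∧-≡ (pair-fits c wy wy∉) (∧-≡ (pair-fits c wz wz∉) (pair-fits c xz xz∉)))))
    either : ∀ {P Q : Set} (p : Maybe P) (q : Maybe Q) → is-just p ∨ is-just q ≡ true → P ⊎ Q
    either (just p) _        _ = inj₁ p
    either nothing  (just q) _ = inj₂ q

  data Shape (w x y z : Fin n) : Set where
    inside-R : role w ≡ R → role x ≡ R → role y ≡ R → role z ≡ R → Shape w x y z
    matched  : Facts S w → Facts S z → x ≡ f w → y ≡ f z → Shape w x y z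
    pendant  : w ≡ v → x ≡ u → y ≡ a → role z ≡ R → Shape w x y z

  Admissible : Case → Set
  Admissible none = ∀ x → role x ≢ R
  Admissible one  = ∀ x y → role x ≡ R → role y ≡ R → x ≡ y
  Admissible many = ⊤

  R-point : ∀ {x} → role x ≡ R → 1 ≤ count (is R)
  R-point role-x = subst (1 ≤_) (sym (count≡sum (is R))) (sumOn-point {p = is R} (λ _ → 1) (is-true role-x))

  R-two-points : ∀ {x y} → x ≢ y → role x ≡ R → role y ≡ R → 2 ≤ count (is R)
  R-two-points x≢y role-x role-y =
    subst (2 ≤_) (sym (count≡sum (is R))) (sumOn-two-points {p = is R} (λ _ → 1) x≢y (is-true role-x) (is-true role-y))

  admissible : Admissible (caseOf (count (is R)))
  admissible with count (is R) in #R
  ... | zero        = λ x role-x → case subst (1 ≤_) #R (R-point role-x) of λ ()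
  ... | suc zero    = unique
    where
    unique : ∀ x y → role x ≡ R → role y ≡ R → x ≡ y
    unique x y role-x role-y with x ≟ y
    ... | yes x≡y = x≡y
    ... | no  x≢y = case subst (2 ≤_) #R (R-two-points x≢y role-x role-y) of λ { (s≤s ()) }
  ... | suc (suc _) = tt

  partner-in-completion : ∀ c {s k} → role s ≡ S → role k ≡ K → adj (completion c) s k ≡ true → k ≡ f s
  partner-in-completion c {s} {k} role-s role-k sk∈ =
    proj₁ (S-nbhd s k (proj₁ (role-facts role-s)) (proj₁ (role-facts role-k)))
          (trans (sym (∨-identityʳ (adj G s k))) (trans (sym (completion-adj c role-s role-k)) sk∈))

  shape-of-pattern : ∀ c → Admissible c → ∀ {p q r t r₁ r₂ r₃ r₄} → RolePattern c r₁ r₂ r₃ r₄ →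
                     role p ≡ r₁ → role q ≡ r₂ → role r ≡ r₃ → role t ≡ r₄ →
                     adj (completion c) p q ≡ true → adj (completion c) t r ≡ true → Shape p q r t
  shape-of-pattern c _ inside-R rp rq rr rt _ _ = inside-R rp rq rr rt
  shape-of-pattern c _ matched  rp rq rr rt pq tr =
    matched (role-facts rp) (role-facts rt) (partner-in-completion c rp rq pq) (partner-in-completion c rt rr tr)
  shape-of-pattern c _ pendant  rp rq rr rt _ _ = pendant (role-facts rp) (role-facts rq) (role-facts rr) rt
  shape-of-pattern none no-R pendant′ rp rq rr rt _ _ = ⊥-elim (no-R _ rt)

  shape : ∀ c → Admissible c → ∀ {w x y z} → InducedP4 (completion c) w x y z → Shape w x y z ⊎ Shape z y x w
  shape c admissible {w} {x} {y} {z} P@(_ , (wx∈ , _ , yz∈) , _) with role-pattern c P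
  ... | inj₁ pat = inj₁ (shape-of-pattern c admissible pat refl refl refl refl wx∈ (trans (Graph.sym (completion c) z y) yz∈))
  ... | inj₂ pat = inj₂ (shape-of-pattern c admissible pat refl refl refl refl (trans (Graph.sym (completion c) z y) yz∈) wx∈)

  pendant-end-unique : ∀ c → Admissible c → ∀ {u′ r r′} → InducedP4 (completion c) v u′ a r →
                       role r ≡ R → role r′ ≡ R → r ≡ r′
  pendant-end-unique none no-R   _ role-r _       = ⊥-elim (no-R _ role-r)
  pendant-end-unique one  unique _ role-r role-r′ = unique _ _ role-r role-r′
  pendant-end-unique many _      (_ , _ , va∉ , _) _ _
    with () ← trans (sym va∉) (trans (completion-adj many role-v role-a) (∨-zeroʳ (adj G v a)))

  module Sparse (G-sparse : P4Sparse G) (c : Case) (admissible : Admissible c)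
                (w : Fin 5 → Fin n) (w-inj : Injective _≡_ _≡_ w) where
    H : Graph n
    H = completion c

    Spans : Quadruple n → Quadruple n → Set
    Spans q q′ = ∀ x → x ∈₄ q ⊎ x ∈₄ q′ → InRange w x

    swap : ∀ {q q′} → Spans q q′ → Spans q′ q
    swap span x = span x ∘ Sum.swap

    ShapeOf : Quadruple n → Set
    ShapeOf (p , q , r , t) = Shape p q r t

    crowded : ∀ xs → AllPairs _≢_ xs → ¬ All (InRange w) xs
    crowded = six-not-among-five w

    R≢S : ∀ {x y} → role x ≡ R → Facts S y → x ≢ y
    R≢S role-x y∈S = role-≢ role-x (role-complete {S} y∈S) λ ()

    in-K : ∀ {s k} → Facts S s → k ≡ f s → part k ≡ inK
    in-K (s∈S , _) refl = f-into _ s∈S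

    R-vs-R : ∀ {p₀ p₁ p₂ p₃ q₀ q₁ q₂ q₃} → InducedP4 H p₀ p₁ p₂ p₃ → InducedP4 H q₀ q₁ q₂ q₃ →
             role p₀ ≡ R → role p₁ ≡ R → role p₂ ≡ R → role p₃ ≡ R →
             role q₀ ≡ R → role q₁ ≡ R → role q₂ ≡ R → role q₃ ≡ R →
             Spans (p₀ , p₁ , p₂ , p₃) (q₀ , q₁ , q₂ , q₃) → SameVertices (p₀ , p₁ , p₂ , p₃) (q₀ , q₁ , q₂ , q₃)
    R-vs-R P P′ p₀ p₁ p₂ p₃ q₀ q₁ q₂ q₃ =
      G-sparse w w-inj _ _ _ _ _ _ _ _ (in-G P p₀ p₁ p₂ p₃) (in-G P′ q₀ q₁ q₂ q₃)
      where
      same : ∀ {x y} → role x ≡ R → role y ≡ R → adj H x y ≡ adj G x y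
      same role-x role-y = trans (completion-adj c role-x role-y) (∨-identityʳ _)
      in-G : ∀ {x₀ x₁ x₂ x₃} → InducedP4 H x₀ x₁ x₂ x₃ →
             role x₀ ≡ R → role x₁ ≡ R → role x₂ ≡ R → role x₃ ≡ R → InducedP4 G x₀ x₁ x₂ x₃
      in-G (distinct , (e01 , e12 , e23) , (n02 , n03 , n13)) r₀ r₁ r₂ r₃ =
        distinct , (trans (sym (same r₀ r₁)) e01 , trans (sym (same r₁ r₂)) e12 , trans (sym (same r₂ r₃)) e23) ,
                   (trans (sym (same r₀ r₂)) n02 , trans (sym (same r₀ r₃)) n03 , trans (sym (same r₁ r₃)) n13)

    R-vs-matched : ∀ {p₀ p₁ p₂ p₃ s k k′ t} → InducedP4 H p₀ p₁ p₂ p₃ → InducedP4 H s k k′ t →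
                   role p₀ ≡ R → role p₁ ≡ R → role p₂ ≡ R → role p₃ ≡ R → Facts S s → Facts S t →
                   ¬ Spans (p₀ , p₁ , p₂ , p₃) (s , k , k′ , t)
    R-vs-matched ((d01 , d02 , d03 , d12 , d13 , d23) , _) ((_ , _ , s≢t , _) , _) r₀ r₁ r₂ r₃ s∈ t∈ span =
      crowded (_ ∷ _ ∷ _ ∷ _ ∷ _ ∷ _ ∷ [])
        ((d01 ∷ d02 ∷ d03 ∷ R≢S r₀ s∈ ∷ R≢S r₀ t∈ ∷ []) ∷ (d12 ∷ d13 ∷ R≢S r₁ s∈ ∷ R≢S r₁ t∈ ∷ []) ∷
         (d23 ∷ R≢S r₂ s∈ ∷ R≢S r₂ t∈ ∷ []) ∷ (R≢S r₃ s∈ ∷ R≢S r₃ t∈ ∷ []) ∷ (s≢t ∷ []) ∷ [] ∷ [])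
        (span _ (inj₁ here₀) ∷ span _ (inj₁ here₁) ∷ span _ (inj₁ here₂) ∷ span _ (inj₁ here₃) ∷
         span _ (inj₂ here₀) ∷ span _ (inj₂ here₃) ∷ [])

    R-vs-pendant : ∀ {p₀ p₁ p₂ p₃ v′ u′ a′ r′} → InducedP4 H p₀ p₁ p₂ p₃ →
                   role p₀ ≡ R → role p₁ ≡ R → role p₂ ≡ R → role p₃ ≡ R → v′ ≡ v → u′ ≡ u →
                   ¬ Spans (p₀ , p₁ , p₂ , p₃) (v′ , u′ , a′ , r′)
    R-vs-pendant ((d01 , d02 , d03 , d12 , d13 , d23) , _) r₀ r₁ r₂ r₃ refl refl span =
      crowded (_ ∷ _ ∷ _ ∷ _ ∷ u ∷ v ∷ [])
        ((d01 ∷ d02 ∷ d03 ∷ R≢u r₀ ∷ R≢v r₀ ∷ []) ∷ (d12 ∷ d13 ∷ R≢u r₁ ∷ R≢v r₁ ∷ []) ∷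
         (d23 ∷ R≢u r₂ ∷ R≢v r₂ ∷ []) ∷ (R≢u r₃ ∷ R≢v r₃ ∷ []) ∷ (u≢v ∷ []) ∷ [] ∷ [])
        (span _ (inj₁ here₀) ∷ span _ (inj₁ here₁) ∷ span _ (inj₁ here₂) ∷ span _ (inj₁ here₃) ∷
         span _ (inj₂ here₁) ∷ span _ (inj₂ here₀) ∷ [])
      where
      R≢u : ∀ {x} → role x ≡ R → x ≢ u
      R≢u role-x = role-≢ role-x role-u λ ()
      R≢v : ∀ {x} → role x ≡ R → x ≢ v
      R≢v role-x = role-≢ role-x role-v λ ()

    matched-vs-pendant : ∀ {s k k′ t v′ u′ a′ r′} → InducedP4 H s k k′ t →
                         Facts S s → Facts S t → k ≡ f s → k′ ≡ f t → v′ ≡ v → u′ ≡ u →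
                         ¬ Spans (s , k , k′ , t) (v′ , u′ , a′ , r′)
    matched-vs-pendant {k = k} {k′} ((d01 , d02 , d03 , d12 , d13 , d23) , _)
                       s∈@(_ , s≢u , s≢v) t∈@(_ , t≢u , t≢v) k≡ k′≡ refl refl span =
      crowded (_ ∷ _ ∷ _ ∷ _ ∷ u ∷ v ∷ [])
        ((d01 ∷ d02 ∷ d03 ∷ s≢u ∷ s≢v ∷ []) ∷
         (d12 ∷ d13 ∷ (S≢K u∈S k∈K ∘ sym) ∷ (S≢K v∈S k∈K ∘ sym) ∷ []) ∷
         (d23 ∷ (S≢K u∈S k′∈K ∘ sym) ∷ (S≢K v∈S k′∈K ∘ sym) ∷ []) ∷ (t≢u ∷ t≢v ∷ []) ∷ (u≢v ∷ []) ∷ [] ∷ [])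
        (span _ (inj₁ here₀) ∷ span _ (inj₁ here₁) ∷ span _ (inj₁ here₂) ∷ span _ (inj₁ here₃) ∷
         span _ (inj₂ here₁) ∷ span _ (inj₂ here₀) ∷ [])
      where
      k∈K : part k ≡ inK
      k∈K = in-K s∈ k≡
      k′∈K : part k′ ≡ inK
      k′∈K = in-K t∈ k′≡

    -- If an S-end e of one matched P4 and its partner f e lie among the five vertices, e is an end of any
    -- other matched P4 there: otherwise its two ends, e, and the three partners would be six vertices.
    S-end-shared : ∀ {e s k k′ t} → Facts S e → InRange w e → InRange w (f e) → InducedP4 H s k k′ t →
                   Facts S s → Facts S t → k ≡ f s → k′ ≡ f t →
                   InRange w s → InRange w k → InRange w k′ → InRange w t → e ≡ s ⊎ e ≡ t
    S-end-shared {e} {s} {k} {k′} {t} (e∈S , _) e-in fe-in ((d01 , d02 , d03 , d12 , d13 , d23) , _)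
                 s∈@(s∈S , _) t∈@(t∈S , _) k≡ k′≡ s-in k-in k′-in t-in with e ≟ s | e ≟ t
    ... | yes e≡s | _       = inj₁ e≡s
    ... | no  _   | yes e≡t = inj₂ e≡t
    ... | no  e≢s | no  e≢t = ⊥-elim (crowded (s ∷ t ∷ e ∷ k ∷ k′ ∷ f e ∷ [])
          ((d03 ∷ (e≢s ∘ sym) ∷ d01 ∷ d02 ∷ S≢K s∈S fe∈K ∷ []) ∷
           ((e≢t ∘ sym) ∷ (d13 ∘ sym) ∷ (d23 ∘ sym) ∷ S≢K t∈S fe∈K ∷ []) ∷
           (S≢K e∈S (in-K s∈ k≡) ∷ S≢K e∈S (in-K t∈ k′≡) ∷ S≢K e∈S fe∈K ∷ []) ∷
           (d12 ∷ subst (_≢ f e) (sym k≡) (f-≢ s∈S e∈S (e≢s ∘ sym)) ∷ []) ∷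
           (subst (_≢ f e) (sym k′≡) (f-≢ t∈S e∈S (e≢t ∘ sym)) ∷ []) ∷ [] ∷ [])
          (s-in ∷ t-in ∷ e-in ∷ k-in ∷ k′-in ∷ fe-in ∷ []))
      where
      fe∈K : part (f e) ≡ inK
      fe∈K = f-into e e∈S

    matched-⊆ : ∀ {s t s′ l l′ t′} → InducedP4 H s′ l l′ t′ →
                Facts S s → Facts S t → Facts S s′ → Facts S t′ → l ≡ f s′ → l′ ≡ f t′ →
                Spans (s , f s , f t , t) (s′ , l , l′ , t′) → ∀ x → x ∈₄ (s , f s , f t , t) → x ∈₄ (s′ , l , l′ , t′)
    matched-⊆ {s} {t} {s′} {l} {l′} {t′} P′ s∈ t∈ s′∈ t′∈ l≡ l′≡ span =
      vertices-⊆ (shared s∈ here₀ here₁) (shared t∈ here₃ here₂)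
      where
      Shared : Fin n → Set
      Shared e = e ≡ s′ ⊎ e ≡ t′
      shared : ∀ {e} → Facts S e → e ∈₄ (s , f s , f t , t) → f e ∈₄ (s , f s , f t , t) → Shared e
      shared e∈ e-at fe-at = S-end-shared e∈ (span _ (inj₁ e-at)) (span _ (inj₁ fe-at)) P′ s′∈ t′∈ l≡ l′≡
                               (span _ (inj₂ here₀)) (span _ (inj₂ here₁)) (span _ (inj₂ here₂)) (span _ (inj₂ here₃))
      partner-⊆ : ∀ {e} → Shared e → f e ∈₄ (s′ , l , l′ , t′)
      partner-⊆ (inj₁ refl) = inj₂ (inj₁ (sym l≡))
      partner-⊆ (inj₂ refl) = inj₂ (inj₂ (inj₁ (sym l′≡)))
      end-⊆ : ∀ {e} → Shared e → e ∈₄ (s′ , l , l′ , t′)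
      end-⊆ (inj₁ refl) = here₀
      end-⊆ (inj₂ refl) = here₃
      vertices-⊆ : Shared s → Shared t → ∀ x → x ∈₄ (s , f s , f t , t) → x ∈₄ (s′ , l , l′ , t′)
      vertices-⊆ s-end t-end x (inj₁ refl)               = end-⊆ s-end
      vertices-⊆ s-end t-end x (inj₂ (inj₁ refl))        = partner-⊆ s-end
      vertices-⊆ s-end t-end x (inj₂ (inj₂ (inj₁ refl))) = partner-⊆ t-end
      vertices-⊆ s-end t-end x (inj₂ (inj₂ (inj₂ refl))) = end-⊆ t-end

    agree : ∀ {q q′} → IsP4 H q → IsP4 H q′ → ShapeOf q → ShapeOf q′ → Spans q q′ → SameVertices q q′
    agree {_ , _ , _ , _} {_ , _ , _ , _} P P′ σ σ′ span with σ | σ′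
    ... | inside-R p₀ p₁ p₂ p₃ | inside-R q₀ q₁ q₂ q₃ = R-vs-R P P′ p₀ p₁ p₂ p₃ q₀ q₁ q₂ q₃ span
    ... | inside-R p₀ p₁ p₂ p₃ | matched s t _ _    = ⊥-elim (R-vs-matched P P′ p₀ p₁ p₂ p₃ s t span)
    ... | inside-R p₀ p₁ p₂ p₃ | pendant v′ u′ _ _  = ⊥-elim (R-vs-pendant P p₀ p₁ p₂ p₃ v′ u′ span)
    ... | matched s t _ _ | inside-R q₀ q₁ q₂ q₃    = ⊥-elim (R-vs-matched P′ P q₀ q₁ q₂ q₃ s t (swap span))
    ... | matched s t refl refl | matched s′ t′ refl refl =
      matched-⊆ P′ s t s′ t′ refl refl span , matched-⊆ P s′ t′ s t refl refl (swap span)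
    ... | matched s t k l | pendant v′ u′ _ _       = ⊥-elim (matched-vs-pendant P s t k l v′ u′ span)
    ... | pendant v′ u′ _ _ | inside-R q₀ q₁ q₂ q₃  = ⊥-elim (R-vs-pendant P′ q₀ q₁ q₂ q₃ v′ u′ (swap span))
    ... | pendant v′ u′ _ _ | matched s t k l       = ⊥-elim (matched-vs-pendant P′ s t k l v′ u′ (swap span))
    ... | pendant refl refl refl r | pendant refl refl refl r′ with pendant-end-unique c admissible P r r′
    ...   | refl = (λ _ → id) , (λ _ → id)

    agree-up-to-reversal : ∀ {p q r t p′ q′ r′ t′} → InducedP4 H p q r t → InducedP4 H p′ q′ r′ t′ →
                           Spans (p , q , r , t) (p′ , q′ , r′ , t′) → SameVertices (p , q , r , t) (p′ , q′ , r′ , t′)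
    agree-up-to-reversal {p} {q} {r} {t} {p′} {q′} {r′} {t′} P P′ span
      with shape c admissible P | shape c admissible P′
    ... | inj₁ σ | inj₁ σ′ = agree {p , q , r , t} {p′ , q′ , r′ , t′} P P′ σ σ′ span
    ... | inj₂ σ | inj₁ σ′ =
      SameVertices-unreverseˡ (agree {t , r , q , p} {p′ , q′ , r′ , t′} (InducedP4-reverse {X = H} P) P′ σ σ′
                                     (λ x → span x ∘ Sum.map₁ (∈₄-unreverse (p , q , r , t))))
    ... | inj₁ σ | inj₂ σ′ =
      SameVertices-unreverseʳ (agree {p , q , r , t} {t′ , r′ , q′ , p′} P (InducedP4-reverse {X = H} P′) σ σ′
                                     (λ x → span x ∘ Sum.map₂ (∈₄-unreverse (p′ , q′ , r′ , t′))))
    ... | inj₂ σ | inj₂ σ′ =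
      SameVertices-unreverseˡ (SameVertices-unreverseʳ
        (agree {t , r , q , p} {t′ , r′ , q′ , p′} (InducedP4-reverse {X = H} P) (InducedP4-reverse {X = H} P′) σ σ′
               (λ x → span x ∘ Sum.map (∈₄-unreverse (p , q , r , t)) (∈₄-unreverse (p′ , q′ , r′ , t′)))))

  completion-sparse : P4Sparse G → ∀ c → Admissible c → P4Sparse (completion c)
  completion-sparse G-sparse c admissible w w-inj _ _ _ _ _ _ _ _ = agree-up-to-reversal
    where open Sparse G-sparse c admissible w w-inj

lemma12 : ∀ {n} (G : Graph n) → P4Sparse G → (T : ThinSpider G) →
          (u v : Fin n) → u ≢ v → adj G u v ≡ false →
          ThinSpider.part T u ≡ inS → ThinSpider.part T v ≡ inS →
          Σ (Graph n) (λ H → Solution G u v H ×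
            fillCount G H ≡ lam (ThinSpider.sizeK T) (ThinSpider.sizeR T) ×
            (∀ H' → Solution G u v H' → fillCount G H ≤ fillCount G H'))
lemma12 G G-sparse spider u v u≢v _ u∈S v∈S =
  completion c , (completion-sparse G-sparse c admissible , G⊆completion c , uv∈completion c) ,
  trans (Completion.completion-fill c) (sym lam≡) ,
  λ { H′ (H′-sparse , G⊆H′ , uv∈H′) →
        subst (_≤ fillCount G H′) (sym (Completion.completion-fill c))
              (Supergraph.LowerBound.fillCount-lower-bound H′ G⊆H′ uv∈H′ H′-sparse) }
  where
  open ThinSpider spider using (sizeK; sizeR)
  open Spider G spider u≢v u∈S v∈S
  c : Case
  c = caseOf (count (is R))
  lam≡ : lam sizeK sizeR ≡ 1 + bonus c + 2 * count (is K)
  lam≡ = trans (cong₂ lam sizeK≡ sizeR≡) (lam-spider (count (is K)) (count (is R)))
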